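{- Let $k\ge2$ and let $r=(r_1,\ldots,r_k)$ be positive integers with $r_1<\cdots<r_k$ and $r_i\mid r_k$ for all $i\in\{1,\ldots,k-1\}$. Let $x_1,\ldots,x_k$ be positive integers and $q=(r_1^{x_1},\ldots,r_k^{x_k})$. If $\Delta_{(1,q)}$ is reflexive and has the integer decomposition property, then, with $p:=(r_1^{x_1},\ldots,r_{k-1}^{x_{k-1}})$ and $h:=(1^{x_k})$, the simplex $\Delta_{(1,q)}$ is an affine free sum of $\Delta_{(1,p)}$ and $\Delta_{(1,h)}$, namely $\Delta_{(1,q)}=\Delta_{(1,p)}\ast_0\Delta_{(1,h)}$ (up to unimodular equivalence). Further, $\Delta_{(1,p)}$ and $\Delta_{(1,h)}$ are both reflexive and have the integer decomposition property.
   Context: $(r_1^{x_1},\ldots,r_k^{x_k})$ denotes the vector with $x_1$ copies of $r_1$, then $x_2$ copies of $r_2$, etc. For $q=(q_1,\ldots,q_n)$, $\Delta_{(1,q)}:=\operatorname{conv}\{e_1,\ldots,e_n,-\sum_i q_ie_i\}\subset\mathbb{R}^n$, with vertices labeled $v_i=e_i$ ($i\ge1$) and $v_0=-\sum_iq_ie_i$. A lattice polytope containing $0$ in its interior is reflexive if its polar is a lattice polytope; for $\Delta_{(1,q)}$ this is equivalent to $q_j\mid 1+\sum_{i\ne j}q_i$ for all $j$. A lattice polytope $P\subset\mathbb{R}^n$ has the integer decomposition property if for every positive integer $m$ and every $w\in mP\cap\mathbb{Z}^n$ there exist $x_1,\ldots,x_m\in P\cap\mathbb{Z}^n$ with $w=x_1+\cdots+x_m$.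 For lattice polytopes $P,Q$, $\operatorname{conv}(P\cup Q)$ is an affine free sum if, up to unimodular equivalence, $P\cap Q=\{0\}$ and the affine spans of $P$ and $Q$ are orthogonal coordinate subspaces. For reflexive $P\subset\mathbb{R}^n$ and reflexive $Q\subset\mathbb{R}^m$ with vertices $v_0,\ldots,v_\ell$, $P\ast_iQ:=\operatorname{conv}\big((P\times 0^m)\cup(0^n\times(Q-v_i))\big)\subset\mathbb{R}^{n+m}$. -}

module Defs where

open import Data.Nat as ℕ using (ℕ; zero; suc)
open import Data.Fin using (Fin; zero; suc)
open import Data.Integer as ℤ using (ℤ; +_)
open import Data.Rational as ℚ using (ℚ; 0ℚ; 1ℚ; _/_)
open import Data.Vec as V using (Vec; []; _∷_)
open import Data.Vec.Functional as VF using (Vector)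
open import Data.Product using (Σ; ∃; ∃-syntax; _×_; _,_)
open import Relation.Binary.PropositionalEquality using (_≡_)
open import Function.Bundles using (_⇔_)

-- Rational points and lattice points of ℝ^n (ℚ^n suffices: all data are rational)
Pt : ℕ → Set
Pt n = Vector ℚ n

ZPt : ℕ → Set
ZPt n = Vector ℤ n

ι : ℤ → ℚ
ι z = z / 1

embed : ∀ {n} → ZPt n → Pt n
embed z j = ι (z j)

∑ℚ : ∀ {m} → (Fin m → ℚ) → ℚ
∑ℚ {zero} f = 0ℚ
∑ℚ {suc m} f = f zero ℚ.+ ∑ℚ (λ i → f (suc i))

∑ℤ : ∀ {m} → (Fin m → ℤ) → ℤ
∑ℤ {zero} f = + 0
∑ℤ {suc m} f = f zero ℤ.+ ∑ℤ (λ i → f (suc i))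

-- A lattice polytope given by a (labelled) finite list of lattice points
-- v_0, …, v_{m-1}; the polytope is their convex hull.
record LPoly (n : ℕ) : Set where
  constructor lpoly
  field
    nv   : ℕ
    vert : Fin nv → ZPt n
open LPoly public

InDil : ∀ {n} → LPoly n → ℚ → Pt n → Set
InDil {n} P c y =
  ∃[ t ] ((∀ i → 0ℚ ℚ.≤ t i)
        × ∑ℚ t ≡ c
        × (∀ (j : Fin n) → ∑ℚ (λ i → t i ℚ.* ι (vert P i j)) ≡ y j))

InP : ∀ {n} → LPoly n → Pt n → Set
InP P y = InDil P 1ℚ y

e : ∀ {n} → Fin n → Pt n
e zero    zero    = 1ℚ
e zero    (suc j) = 0ℚ
e (suc i) zero    = 0ℚ
e (suc i) (suc j) = e i j

scale : ∀ {n} → ℚ → Pt n → Pt n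
scale c y j = c ℚ.* y j

-- 0 lies in the interior of P: some cross-polytope {±ε e_j} around 0 lies in P
ZeroInInterior : ∀ {n} → LPoly n → Set
ZeroInInterior {n} P =
  ∃[ ε ] (0ℚ ℚ.< ε × (∀ (j : Fin n) → InP P (scale ε (e j)) × InP P (scale (ℚ.- ε) (e j))))

dot : ∀ {n} → Pt n → Pt n → ℚ
dot x y = ∑ℚ (λ j → x j ℚ.* y j)

InPolar : ∀ {n} → LPoly n → Pt n → Set
InPolar P y = ∀ x → InP P x → ℚ.- 1ℚ ℚ.≤ dot x y

half : ℚ
half = + 1 / 2

midpoint : ∀ {n} → Pt n → Pt n → Pt n
midpoint a b j = half ℚ.* (a j ℚ.+ b j)

PolarVertex : ∀ {n} → LPoly n → Pt n → Set
PolarVertex P y =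
  InPolar P y × (∀ a b → InPolar P a → InPolar P b →
                   (∀ j → y j ≡ midpoint a b j) → ∀ j → a j ≡ b j)

IsLatticePoint : ∀ {n} → Pt n → Set
IsLatticePoint {n} y = Σ (ZPt n) (λ z → ∀ j → y j ≡ ι (z j))

-- reflexive: 0 in the interior and the polar is a lattice polytope
-- (all vertices of the polar are lattice points)
Reflexive : ∀ {n} → LPoly n → Set
Reflexive P = ZeroInInterior P × (∀ y → PolarVertex P y → IsLatticePoint y)

IDP : ∀ {n} → LPoly n → Set
IDP {n} P =
  ∀ (m : ℕ) (w : ZPt n) → InDil P (+ suc m / 1) (embed w) →
    Σ (Fin (suc m) → ZPt n) (λ xs → (∀ i → InP P (embed (xs i)))
           × (∀ j → ∑ℤ (λ i → xs i j) ≡ w j))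

-- Δ_(1,q) = conv{e_1,…,e_n, -∑ q_i e_i}; label v_0 = -∑ q_i e_i is index zero
eZ : ∀ {n} → Fin n → ZPt n
eZ zero    zero    = + 1
eZ zero    (suc j) = + 0
eZ (suc i) zero    = + 0
eZ (suc i) (suc j) = eZ i j

Δ : ∀ {n} → Vector ℕ n → LPoly n
Δ {n} q = lpoly (suc n) v
  where
  v : Fin (suc n) → ZPt n
  v zero    = λ j → ℤ.- (+ q j)
  v (suc i) = eZ i

-- P ∗_i Q = conv((P × 0) ∪ (0 × (Q - v_i)))
star : ∀ {a b} → LPoly a → (Q : LPoly b) → Fin (nv Q) → LPoly (a ℕ.+ b)
star {a} {b} P Q i0 =
  lpoly (nv P ℕ.+ nv Q)
    ((λ i → vert P i VF.++ (λ _ → + 0))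
     VF.++ (λ i → (λ _ → + 0) VF.++ (λ j → vert Q i j ℤ.- vert Q i0 j)))

ZMat : ℕ → Set
ZMat n = Fin n → Fin n → ℤ

_·ᵐ_ : ∀ {n} → ZMat n → ZMat n → ZMat n
(U ·ᵐ W) i k = ∑ℤ (λ j → U i j ℤ.* W j k)

Id : ∀ {n} → ZMat n
Id i j = eZ i j

act : ∀ {n} → ZMat n → ZPt n → Pt n → Pt n
act U b y i = ∑ℚ (λ j → ι (U i j) ℚ.* y j) ℚ.+ ι (b i)

UnimodEquiv : ∀ {n} → LPoly n → LPoly n → Set
UnimodEquiv {n} P Q =
  ∃[ U ] ∃[ U' ] ∃[ b ]
    ((∀ i j → (U ·ᵐ U') i j ≡ Id i j) × (∀ i j → (U' ·ᵐ U) i j ≡ Id i j)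
     × (∀ (y : Pt n) → InP P y ⇔ InP Q (act U b y)))

-- (r_1^{x_1},…,r_k^{x_k}) as a functional vector of length x_1+…+x_k
expand : ∀ {k} → Vec ℕ k → (x : Vec ℕ k) → Vector ℕ (V.sum x)
expand []       []       = λ ()
expand (r ∷ rs) (x ∷ xs) = VF.replicate x r VF.++ expand rs xs

module Submission where

-- The argument works for an arbitrary weight vector p (module Simplices):
--  * membership in c·Δ_q is described by one barycentric coordinate t_0
--    (DilCoords), and the polar of Δ_q is { y ≥ -1 , ∑ q_i y_i ≤ 1 };
--  * its vertices are (-1,…,-1) and -1 + (N_q/q_k) e_k with N_q = 1 + ∑ q_i, which
--    gives the reflexivity criterion: Δ_q is reflexive iff q_k ∣ N_q for all k;
--  * for q = (p, rk^m), reflexivity yields rk ∣ N_p, and decomposing the lattice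
--    point (0,…,0,-1,…,-1) with the IDP forces rk = N_p;
--  * once rk = N_p, an explicit integer shear maps Δ_q onto Δ_p ∗_0 Δ_(1^m),
--    the criterion makes both factors reflexive, and lifting points of c·Δ_p and
--    c·Δ_(1^m) into c·Δ_q transfers the IDP to both factors.

module Simplices where
  open import Defs
  open import Data.Nat as ℕ using (ℕ; zero; suc)
  import Data.Nat.Properties as ℕP
  import Data.Nat.Coprimality as C
  open import Data.Nat.Divisibility using (_∣_; divides; ∣m+n∣m⇒∣n; 1∣_)
  open import Data.Integer as ℤ using (ℤ; +_)
  import Data.Integer.Properties as ℤP
  open import Data.Rational as ℚ using (ℚ; 0ℚ; 1ℚ; mkℚ; _+_; _*_; -_; _-_; _≤_; _<_; ↥_; _/_)
  import Data.Rational.Properties as ℚP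
  open import Data.Fin as F using (Fin; zero; suc; _↑ˡ_; _↑ʳ_)
  import Data.Fin.Properties as FP
  open import Data.Vec.Functional as VF using (Vector)
  open import Data.Product using (Σ; ∃; _×_; _,_; proj₁; proj₂)
  open import Data.Sum using (_⊎_; inj₁; inj₂; [_,_])
  open import Data.Empty using (⊥; ⊥-elim)
  open import Data.Maybe using (Maybe; nothing; just)
  open import Relation.Nullary using (¬_; yes; no; Dec)
  open import Relation.Binary.PropositionalEquality hiding ([_])
  open import Function using (_∘_)
  open import Function.Bundles using (mk⇔)
  open import Tactic.RingSolver
  open import Tactic.RingSolver.Core.AlmostCommutativeRing

  isZ : (x : ℚ) → Maybe (0ℚ ≡ x)
  isZ x with 0ℚ ℚP.≟ x
  ... | yes p = just p
  ... | no _ = nothing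

  ℚring : AlmostCommutativeRing _ _
  ℚring = fromCommutativeRing ℚP.+-*-commutativeRing isZ

  ιmk : ∀ z → ι z ≡ mkℚ z 0 (C.sym (C.1-coprimeTo _))
  ιmk z = ℚP.↥p/↧p≡p (mkℚ z 0 (C.sym (C.1-coprimeTo _)))

  ↥ι : ∀ z → ↥ (ι z) ≡ z
  ↥ι z = cong ↥_ (ιmk z)

  ι-inj : ∀ {a b} → ι a ≡ ι b → a ≡ b
  ι-inj {a} {b} p = trans (sym (↥ι a)) (trans (cong ↥_ p) (↥ι b))

  ι+ : ∀ a b → ι (a ℤ.+ b) ≡ ι a + ι b
  ι+ a b = trans (cong (λ z → z / 1) (cong₂ ℤ._+_ (sym (ℤP.*-identityʳ a)) (sym (ℤP.*-identityʳ b))))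
                 (sym (cong₂ _+_ (ιmk a) (ιmk b)))

  ι* : ∀ a b → ι (a ℤ.* b) ≡ ι a * ι b
  ι* a b = sym (cong₂ _*_ (ιmk a) (ιmk b))

  ι- : ∀ a → ι (ℤ.- a) ≡ - ι a
  ι- a = begin
    ι (ℤ.- a)                        ≡⟨ lem (ι (ℤ.- a)) (ι a) ⟩
    (ι (ℤ.- a) + ι a) - ι a          ≡⟨ cong (_- ι a) (sym (ι+ (ℤ.- a) a)) ⟩
    ι (ℤ.- a ℤ.+ a) - ι a            ≡⟨ cong (λ z → ι z - ι a) (ℤP.+-inverseˡ a) ⟩
    0ℚ - ι a                         ≡⟨ ℚP.+-identityˡ (- ι a) ⟩
    - ι a ∎
    where
    open ≡-Reasoning
    lem : ∀ x y → x ≡ (x + y) - y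
    lem = solve-∀ ℚring

  ι-sub : ∀ a b → ι (a ℤ.- b) ≡ ι a - ι b
  ι-sub a b = trans (ι+ a (ℤ.- b)) (cong (λ z → ι a + z) (ι- b))

  ι≤ : ∀ {a b} → a ℤ.≤ b → ι a ≤ ι b
  ι≤ {a} {b} p rewrite ιmk a | ιmk b =
    ℚ.*≤* (subst₂ ℤ._≤_ (sym (ℤP.*-identityʳ a)) (sym (ℤP.*-identityʳ b)) p)

  ι< : ∀ {a b} → a ℤ.< b → ι a < ι b
  ι< {a} {b} p rewrite ιmk a | ιmk b =
    ℚ.*<* (subst₂ ℤ._<_ (sym (ℤP.*-identityʳ a)) (sym (ℤP.*-identityʳ b)) p)

  ι<⁻ : ∀ {a b} → ι a < ι b → a ℤ.< b
  ι<⁻ {a} {b} p rewrite ιmk a | ιmk b with p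
  ... | ℚ.*<* q = subst₂ ℤ._<_ (ℤP.*-identityʳ a) (ℤP.*-identityʳ b) q

  ιn : ℕ → ℚ
  ιn k = ι (+ k)

  ιn-suc : ∀ k → ιn (suc k) ≡ 1ℚ + ιn k
  ιn-suc k = ι+ (+ 1) (+ k)

  ιn+ : ∀ a b → ιn (a ℕ.+ b) ≡ ιn a + ιn b
  ιn+ a b = ι+ (+ a) (+ b)

  ιn* : ∀ a b → ιn (a ℕ.* b) ≡ ιn a * ιn b
  ιn* a b = trans (cong ι (ℤP.pos-* a b)) (ι* (+ a) (+ b))

  0≤+ : ∀ {x y} → 0ℚ ≤ x → 0ℚ ≤ y → 0ℚ ≤ x + y
  0≤+ p q = ℚP.+-mono-≤ p q

  0<+ : ∀ {x y} → 0ℚ < x → 0ℚ ≤ y → 0ℚ < x + y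
  0<+ p q = ℚP.+-mono-<-≤ p q

  0≤* : ∀ {x y} → 0ℚ ≤ x → 0ℚ ≤ y → 0ℚ ≤ x * y
  0≤* {x} {y} p q = subst (_≤ x * y) (ℚP.*-zeroˡ y)
    (ℚP.*-monoʳ-≤-nonNeg y {{ℚ.nonNegative q}} p)

  0<* : ∀ {x y} → 0ℚ < x → 0ℚ < y → 0ℚ < x * y
  0<* {x} {y} p q = subst (_< x * y) (ℚP.*-zeroˡ y)
    (ℚP.*-monoˡ-<-pos y {{ℚ.positive q}} p)

  ≤→0≤ : ∀ {x y} → x ≤ y → 0ℚ ≤ y - x
  ≤→0≤ {x} {y} p = subst (_≤ y - x) (ℚP.+-inverseʳ x) (ℚP.+-monoˡ-≤ (- x) p)

  <→0< : ∀ {x y} → x < y → 0ℚ < y - x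
  <→0< {x} {y} p = subst (_< y - x) (ℚP.+-inverseʳ x) (ℚP.+-monoˡ-< (- x) p)

  0≤→≤ : ∀ {x y} → 0ℚ ≤ y - x → x ≤ y
  0≤→≤ {x} {y} p = subst₂ _≤_ (ℚP.+-identityˡ x) (lem x y) (ℚP.+-monoˡ-≤ x p)
    where lem : ∀ x y → y - x + x ≡ y
          lem = solve-∀ ℚring

  0<→< : ∀ {x y} → 0ℚ < y - x → x < y
  0<→< {x} {y} p = subst₂ _<_ (ℚP.+-identityˡ x) (lem x y) (ℚP.+-monoˡ-< x p)
    where lem : ∀ x y → y - x + x ≡ y
          lem = solve-∀ ℚring

  ≤-by : ∀ {X Y} E → Y - X ≡ E → 0ℚ ≤ E → X ≤ Y
  ≤-by E eq p = 0≤→≤ (subst (0ℚ ≤_) (sym eq) p)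

  0≤-by : ∀ {X} E → X ≡ E → 0ℚ ≤ E → 0ℚ ≤ X
  0≤-by E eq p = subst (0ℚ ≤_) (sym eq) p

  0≤1 : 0ℚ ≤ 1ℚ
  0≤1 = ℚP.<⇒≤ (ℚ.*<* (ℤ.+<+ (ℕ.s≤s ℕ.z≤n)))

  0<1 : 0ℚ < 1ℚ
  0<1 = ℚ.*<* (ℤ.+<+ (ℕ.s≤s ℕ.z≤n))

  0≤ιn : ∀ k → 0ℚ ≤ ιn k
  0≤ιn k = ι≤ {+ 0} {+ k} (ℤ.+≤+ ℕ.z≤n)

  0<ιn : ∀ {k} → 0 ℕ.< k → 0ℚ < ιn k
  0<ιn {k} p = ι< {+ 0} {+ k} (ℤ.+<+ p)

  1≤ιn : ∀ {k} → 0 ℕ.< k → 1ℚ ≤ ιn k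
  1≤ιn {k} p = ι≤ {+ 1} {+ k} (ℤ.+≤+ p)

  inv : (x : ℚ) → 0ℚ < x → Σ ℚ (λ u → 0ℚ < u × x * u ≡ 1ℚ)
  inv x p = (ℚ.1/ x) {{nz}} , pos , ℚP.*-inverseʳ x {{nz}}
    where
    instance
      px : ℚ.Positive x
      px = ℚ.positive p
    nz : ℚ.NonZero x
    nz = ℚP.pos⇒nonZero x
    pos : 0ℚ < (ℚ.1/ x) {{nz}}
    pos = ℚP.positive⁻¹ _ {{ℚP.1/pos⇒pos x}}

  *-cancel : ∀ {c a b} → 0ℚ < c → c * a ≡ c * b → a ≡ b
  *-cancel {c} {a} {b} p eq with inv c p
  ... | u , _ , cu = begin
    a                ≡⟨ sym (ℚP.*-identityˡ a) ⟩
    1ℚ * a           ≡⟨ cong (_* a) (sym cu) ⟩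
    (c * u) * a      ≡⟨ lem c u a ⟩
    u * (c * a)      ≡⟨ cong (u *_) eq ⟩
    u * (c * b)      ≡⟨ sym (lem c u b) ⟩
    (c * u) * b      ≡⟨ cong (_* b) cu ⟩
    1ℚ * b           ≡⟨ ℚP.*-identityˡ b ⟩
    b ∎
    where open ≡-Reasoning
          lem : ∀ c u a → (c * u) * a ≡ u * (c * a)
          lem = solve-∀ ℚring

  ∑-cong : ∀ {m} {f g : Fin m → ℚ} → (∀ i → f i ≡ g i) → ∑ℚ f ≡ ∑ℚ g
  ∑-cong {zero} h = refl
  ∑-cong {suc m} h = cong₂ _+_ (h zero) (∑-cong (h ∘ suc))

  ∑-+ : ∀ {m} (f g : Fin m → ℚ) → ∑ℚ (λ i → f i + g i) ≡ ∑ℚ f + ∑ℚ g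
  ∑-+ {zero} f g = refl
  ∑-+ {suc m} f g = trans (cong (λ z → f zero + g zero + z) (∑-+ (f ∘ suc) (g ∘ suc)))
                          (lem (f zero) (g zero) (∑ℚ (f ∘ suc)) (∑ℚ (g ∘ suc)))
    where lem : ∀ a b c d → a + b + (c + d) ≡ a + c + (b + d)
          lem = solve-∀ ℚring

  ∑-* : ∀ {m} (c : ℚ) (f : Fin m → ℚ) → ∑ℚ (λ i → c * f i) ≡ c * ∑ℚ f
  ∑-* {zero} c f = sym (ℚP.*-zeroʳ c)
  ∑-* {suc m} c f = trans (cong (λ z → c * f zero + z) (∑-* c (f ∘ suc)))
                          (sym (ℚP.*-distribˡ-+ c (f zero) (∑ℚ (f ∘ suc))))

  ∑-*ʳ : ∀ {m} (c : ℚ) (f : Fin m → ℚ) → ∑ℚ (λ i → f i * c) ≡ ∑ℚ f * c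
  ∑-*ʳ c f = trans (∑-cong (λ i → ℚP.*-comm (f i) c)) (trans (∑-* c f) (ℚP.*-comm c (∑ℚ f)))

  ∑-neg : ∀ {m} (f : Fin m → ℚ) → ∑ℚ (λ i → - f i) ≡ - ∑ℚ f
  ∑-neg {zero} f = refl
  ∑-neg {suc m} f = trans (cong (λ z → - f zero + z) (∑-neg (f ∘ suc))) (sym (ℚP.neg-distrib-+ (f zero) (∑ℚ (f ∘ suc))))

  ∑-sub : ∀ {m} (f g : Fin m → ℚ) → ∑ℚ (λ i → f i - g i) ≡ ∑ℚ f - ∑ℚ g
  ∑-sub f g = trans (∑-+ f (λ i → - g i)) (cong (λ z → ∑ℚ f + z) (∑-neg g))

  ∑-0 : ∀ {m} → ∑ℚ {m} (λ _ → 0ℚ) ≡ 0ℚ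
  ∑-0 {zero} = refl
  ∑-0 {suc m} = trans (ℚP.+-identityˡ _) (∑-0 {m})

  ∑-const : ∀ {m} (c : ℚ) → ∑ℚ {m} (λ _ → c) ≡ ιn m * c
  ∑-const {zero} c = sym (ℚP.*-zeroˡ c)
  ∑-const {suc m} c = trans (cong (λ z → c + z) (∑-const {m} c))
    (trans (lem c (ιn m)) (cong (_* c) (sym (ιn-suc m))))
    where lem : ∀ c k → c + k * c ≡ (1ℚ + k) * c
          lem = solve-∀ ℚring

  ∑-nonneg : ∀ {m} {f : Fin m → ℚ} → (∀ i → 0ℚ ≤ f i) → 0ℚ ≤ ∑ℚ f
  ∑-nonneg {zero} h = ℚP.≤-refl
  ∑-nonneg {suc m} h = 0≤+ (h zero) (∑-nonneg (h ∘ suc))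

  ∑-single : ∀ {m} {f : Fin m → ℚ} → (∀ i → 0ℚ ≤ f i) → ∀ k → f k ≤ ∑ℚ f
  ∑-single {suc m} {f} h zero = subst (_≤ ∑ℚ f) (ℚP.+-identityʳ (f zero))
    (ℚP.+-monoʳ-≤ (f zero) (∑-nonneg (h ∘ suc)))
  ∑-single {suc m} {f} h (suc k) = subst (_≤ ∑ℚ f) (ℚP.+-identityˡ (f (suc k)))
    (ℚP.+-mono-≤ (h zero) (∑-single (h ∘ suc) k))

  ∑-zero-each : ∀ {m} {f : Fin m → ℚ} → (∀ i → 0ℚ ≤ f i) → ∑ℚ f ≡ 0ℚ → ∀ k → f k ≡ 0ℚ
  ∑-zero-each h eq k = ℚP.≤-antisym (subst (_ ≤_) eq (∑-single h k)) (h k)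

  ∑-swap : ∀ {m k} (f : Fin m → Fin k → ℚ) → ∑ℚ (λ i → ∑ℚ (λ j → f i j)) ≡ ∑ℚ (λ j → ∑ℚ (λ i → f i j))
  ∑-swap {zero} {k} f = sym (∑-0 {k})
  ∑-swap {suc m} {k} f = trans (cong (λ z → ∑ℚ (f zero) + z) (∑-swap (f ∘ suc)))
                               (sym (∑-+ (λ j → f zero j) (λ j → ∑ℚ (λ i → f (suc i) j))))

  ∑-split : ∀ a b (f : Fin (a ℕ.+ b) → ℚ) → ∑ℚ f ≡ ∑ℚ (λ i → f (i ↑ˡ b)) + ∑ℚ (λ i → f (a ↑ʳ i))
  ∑-split zero b f = sym (ℚP.+-identityˡ _)
  ∑-split (suc a) b f = trans (cong (λ z → f zero + z) (∑-split a b (f ∘ suc)))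
                              (sym (ℚP.+-assoc (f zero) _ _))

  ι∑ : ∀ {m} (f : Fin m → ℤ) → ι (∑ℤ f) ≡ ∑ℚ (λ i → ι (f i))
  ι∑ {zero} f = refl
  ι∑ {suc m} f = trans (ι+ (f zero) (∑ℤ (f ∘ suc))) (cong (λ z → ι (f zero) + z) (ι∑ (f ∘ suc)))

  eι : ∀ {n} (i j : Fin n) → e i j ≡ ι (eZ i j)
  eι zero zero = refl
  eι zero (suc j) = refl
  eι (suc i) zero = refl
  eι (suc i) (suc j) = eι i j

  eZ-sym : ∀ {n} (i j : Fin n) → eZ i j ≡ eZ j i
  eZ-sym zero zero = refl
  eZ-sym zero (suc j) = refl
  eZ-sym (suc i) zero = refl
  eZ-sym (suc i) (suc j) = eZ-sym i j

  eZ-diag : ∀ {n} (i : Fin n) → eZ i i ≡ + 1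
  eZ-diag zero = refl
  eZ-diag (suc i) = eZ-diag i

  eZ-off : ∀ {n} (i j : Fin n) → i ≢ j → eZ i j ≡ + 0
  eZ-off zero zero ne = ⊥-elim (ne refl)
  eZ-off zero (suc j) ne = refl
  eZ-off (suc i) zero ne = refl
  eZ-off (suc i) (suc j) ne = eZ-off i j (λ eq → ne (cong suc eq))

  sel : ∀ {n} (f : Fin n → ℚ) (j : Fin n) → ∑ℚ (λ i → f i * ι (eZ i j)) ≡ f j
  sel {suc n} f zero = trans (cong₂ _+_ (ℚP.*-identityʳ (f zero))
                                        (trans (∑-cong (λ i → ℚP.*-zeroʳ (f (suc i)))) (∑-0 {n})))
                             (ℚP.+-identityʳ (f zero))
  sel {suc n} f (suc j) = trans (cong₂ _+_ (ℚP.*-zeroʳ (f zero)) (sel (f ∘ suc) j)) (ℚP.+-identityˡ _)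

  sel' : ∀ {n} (f : Fin n → ℚ) (j : Fin n) → ∑ℚ (λ i → f i * ι (eZ j i)) ≡ f j
  sel' f j = trans (∑-cong (λ i → cong (λ z → f i * ι z) (eZ-sym j i))) (sel f j)

  sel-e : ∀ {n} (f : Fin n → ℚ) (j : Fin n) → ∑ℚ (λ i → f i * e j i) ≡ f j
  sel-e f j = trans (∑-cong (λ i → cong (f i *_) (eι j i))) (sel' f j)

  e-01 : ∀ {n} (i j : Fin n) → (e i j ≡ 0ℚ) ⊎ (e i j ≡ 1ℚ)
  e-01 zero zero = inj₂ refl
  e-01 zero (suc j) = inj₁ refl
  e-01 (suc i) zero = inj₁ refl
  e-01 (suc i) (suc j) = e-01 i j

  e-nonneg : ∀ {n} (i j : Fin n) → 0ℚ ≤ e i j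
  e-nonneg i j with e-01 i j
  ... | inj₁ p = subst (0ℚ ≤_) (sym p) ℚP.≤-refl
  ... | inj₂ p = subst (0ℚ ≤_) (sym p) 0≤1

  e-≤1 : ∀ {n} (i j : Fin n) → e i j ≤ 1ℚ
  e-≤1 i j with e-01 i j
  ... | inj₁ p = subst (_≤ 1ℚ) (sym p) 0≤1
  ... | inj₂ p = subst (_≤ 1ℚ) (sym p) ℚP.≤-refl

  e-diag : ∀ {n} (i : Fin n) → e i i ≡ 1ℚ
  e-diag i = trans (eι i i) (cong ι (eZ-diag i))

  e-off : ∀ {n} (i j : Fin n) → i ≢ j → e i j ≡ 0ℚ
  e-off i j ne = trans (eι i j) (cong ι (eZ-off i j ne))

  split-ind : ∀ {a b} (P : Fin (a ℕ.+ b) → Set) → (∀ i → P (i ↑ˡ b)) → (∀ i → P (a ↑ʳ i)) → ∀ j → P j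
  split-ind {zero} P f g j = g j
  split-ind {suc a} P f g zero = f zero
  split-ind {suc a} P f g (suc j) = split-ind {a} (P ∘ suc) (f ∘ suc) g j

  ++ˡ : ∀ {A : Set} {a b} (f : Vector A a) (g : Vector A b) i → (f VF.++ g) (i ↑ˡ b) ≡ f i
  ++ˡ {a = a} {b} f g i = cong [ f , g ] (FP.splitAt-↑ˡ a i b)

  ++ʳ : ∀ {A : Set} {a b} (f : Vector A a) (g : Vector A b) i → (f VF.++ g) (a ↑ʳ i) ≡ g i
  ++ʳ {a = a} {b} f g i = cong [ f , g ] (FP.splitAt-↑ʳ a b i)

  eZ-ll : ∀ {a} b (i j : Fin a) → eZ (i ↑ˡ b) (j ↑ˡ b) ≡ eZ i j
  eZ-ll b zero zero = refl
  eZ-ll b zero (suc j) = refl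
  eZ-ll b (suc i) zero = refl
  eZ-ll b (suc i) (suc j) = eZ-ll b i j

  eZ-rr : ∀ a {b} (i j : Fin b) → eZ (a ↑ʳ i) (a ↑ʳ j) ≡ eZ i j
  eZ-rr zero i j = refl
  eZ-rr (suc a) i j = eZ-rr a i j

  eZ-lr : ∀ {a} b (i : Fin a) (j : Fin b) → eZ (i ↑ˡ b) (a ↑ʳ j) ≡ + 0
  eZ-lr b zero j = refl
  eZ-lr b (suc i) j = eZ-lr b i j

  eZ-rl : ∀ {a} b (i : Fin a) (j : Fin b) → eZ (a ↑ʳ j) (i ↑ˡ b) ≡ + 0
  eZ-rl {a} b i j = trans (eZ-sym (a ↑ʳ j) (i ↑ˡ b)) (eZ-lr b i j)

  Σq : ∀ {n} → Vector ℕ n → ℚ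
  Σq q = ∑ℚ (λ i → ιn (q i))

  Nq : ∀ {n} → Vector ℕ n → ℚ
  Nq q = 1ℚ + Σq q

  -- Writing y = t_0 v_0 + ∑ t_j e_j forces
  -- t_j = y_j + q_j t_0, so y ∈ c·Δ_q iff some t_0 ≥ 0 satisfies
  -- t_0 N_q = c - ∑ y and y_j + q_j t_0 ≥ 0 for all j.
  DilCoords : ∀ {n} → Vector ℕ n → ℚ → Pt n → Set
  DilCoords q c y = Σ ℚ (λ t0 → 0ℚ ≤ t0 × t0 * Nq q ≡ c - ∑ℚ y × (∀ j → 0ℚ ≤ y j + ιn (q j) * t0))

  coord : ∀ {n} (q : Vector ℕ n) (t : Fin (suc n) → ℚ) j →
          ∑ℚ (λ i → t i * ι (vert (Δ q) i j)) ≡ t zero * (- ιn (q j)) + t (suc j)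
  coord q t j = cong₂ _+_ (cong (t zero *_) (ι- (+ q j))) (sel (t ∘ suc) j)

  tsum : ∀ {n} (q : Vector ℕ n) (y : Pt n) t0 →
         ∑ℚ (λ j → y j + ιn (q j) * t0) ≡ ∑ℚ y + Σq q * t0
  tsum q y t0 = trans (∑-+ y (λ j → ιn (q j) * t0)) (cong (λ z → ∑ℚ y + z) (∑-*ʳ t0 (λ j → ιn (q j))))

  dil⇒coords : ∀ {n} (q : Vector ℕ n) c y → InDil (Δ q) c y → DilCoords q c y
  dil⇒coords q c y (t , nn , sm , co) = t zero , nn zero , sumEq , coordNN
    where
    tsj : ∀ j → t (suc j) ≡ y j + ιn (q j) * t zero
    tsj j = trans (lem (t (suc j)) (t zero) (ιn (q j)))
                  (cong (λ z → z + ιn (q j) * t zero) (trans (sym (coord q t j)) (co j)))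
      where lem : ∀ a b c → a ≡ (b * (- c) + a) + c * b
            lem = solve-∀ ℚring
    coordNN : ∀ j → 0ℚ ≤ y j + ιn (q j) * t zero
    coordNN j = subst (0ℚ ≤_) (tsj j) (nn (suc j))
    sumEq : t zero * Nq q ≡ c - ∑ℚ y
    sumEq = begin
      t zero * Nq q                          ≡⟨ lem (t zero) (∑ℚ y) (Σq q) ⟩
      (t zero + (∑ℚ y + Σq q * t zero)) - ∑ℚ y ≡⟨ cong (λ z → (t zero + z) - ∑ℚ y) (sym (tsum q y (t zero))) ⟩
      (t zero + ∑ℚ (λ j → y j + ιn (q j) * t zero)) - ∑ℚ y ≡⟨ cong (λ z → (t zero + z) - ∑ℚ y) (sym (∑-cong tsj)) ⟩
      (t zero + ∑ℚ (t ∘ suc)) - ∑ℚ y           ≡⟨ cong (_- ∑ℚ y) sm ⟩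
      c - ∑ℚ y ∎
      where open ≡-Reasoning
            lem : ∀ a b s → a * (1ℚ + s) ≡ (a + (b + s * a)) - b
            lem = solve-∀ ℚring

  coords⇒dil : ∀ {n} (q : Vector ℕ n) c y → DilCoords q c y → InDil (Δ q) c y
  coords⇒dil {n} q c y (t0 , t0nn , eq , cnn) = t , nn , sm , co
    where
    t : Fin (suc n) → ℚ
    t zero = t0
    t (suc j) = y j + ιn (q j) * t0
    nn : ∀ i → 0ℚ ≤ t i
    nn zero = t0nn
    nn (suc j) = cnn j
    sm : ∑ℚ t ≡ c
    sm = begin
      t0 + ∑ℚ (λ j → y j + ιn (q j) * t0) ≡⟨ cong (λ z → t0 + z) (tsum q y t0) ⟩
      t0 + (∑ℚ y + Σq q * t0)               ≡⟨ lem t0 (∑ℚ y) (Σq q) ⟩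
      t0 * Nq q + ∑ℚ y                      ≡⟨ cong (_+ ∑ℚ y) eq ⟩
      c - ∑ℚ y + ∑ℚ y                       ≡⟨ lem2 c (∑ℚ y) ⟩
      c ∎
      where open ≡-Reasoning
            lem : ∀ a b s → a + (b + s * a) ≡ a * (1ℚ + s) + b
            lem = solve-∀ ℚring
            lem2 : ∀ a b → a - b + b ≡ a
            lem2 = solve-∀ ℚring
    co : ∀ j → ∑ℚ (λ i → t i * ι (vert (Δ q) i j)) ≡ y j
    co j = trans (coord q t j) (lem t0 (ιn (q j)) (y j))
      where lem : ∀ a b c → a * (- b) + (c + b * a) ≡ c
            lem = solve-∀ ℚring

  L : ∀ {n} → Vector ℕ n → Pt n → ℚ
  L q y = ∑ℚ (λ i → ιn (q i) * y i)

  L-lin : ∀ {n} (q : Vector ℕ n) (y d : Pt n) δ → L q (λ i → y i + δ * d i) ≡ L q y + δ * L q d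
  L-lin q y d δ = trans (∑-cong (λ i → lem (ιn (q i)) (y i) δ (d i)))
    (trans (∑-+ (λ i → ιn (q i) * y i) (λ i → δ * (ιn (q i) * d i)))
           (cong (λ z → L q y + z) (∑-* δ (λ i → ιn (q i) * d i))))
    where lem : ∀ a b c d → a * (b + c * d) ≡ a * b + c * (a * d)
          lem = solve-∀ ℚring

  L-e : ∀ {n} (q : Vector ℕ n) k → L q (e k) ≡ ιn (q k)
  L-e q k = sel-e (λ i → ιn (q i)) k

  L-rep : ∀ {n} (q : Vector ℕ n) k w → L q (λ i → - 1ℚ + w * e k i) ≡ - Σq q + w * ιn (q k)
  L-rep q k w = trans (L-lin q (λ _ → - 1ℚ) (e k) w)
    (cong₂ _+_ (trans (∑-cong (λ i → lem (ιn (q i)))) (∑-neg (λ i → ιn (q i))))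
               (cong (w *_) (L-e q k)))
    where lem : ∀ a → a * (- 1ℚ) ≡ - a
          lem = solve-∀ ℚring

  ∑e : ∀ {n} (k : Fin n) → ∑ℚ (e k) ≡ 1ℚ
  ∑e k = trans (∑-cong (λ i → sym (ℚP.*-identityˡ (e k i)))) (sel-e (λ _ → 1ℚ) k)

  e∈Δ : ∀ {n} (q : Vector ℕ n) k → InP (Δ q) (e k)
  e∈Δ q k = coords⇒dil q 1ℚ (e k) (0ℚ , ℚP.≤-refl , eq , nn)
    where
    eq : 0ℚ * Nq q ≡ 1ℚ - ∑ℚ (e k)
    eq = trans (ℚP.*-zeroˡ (Nq q)) (trans (sym (ℚP.+-inverseʳ 1ℚ)) (cong (λ z → 1ℚ - z) (sym (∑e k))))
    nn : ∀ j → 0ℚ ≤ e k j + ιn (q j) * 0ℚ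
    nn j = subst (0ℚ ≤_) (sym (trans (cong (λ z → e k j + z) (ℚP.*-zeroʳ (ιn (q j)))) (ℚP.+-identityʳ (e k j)))) (e-nonneg k j)

  v0 : ∀ {n} → Vector ℕ n → Pt n
  v0 q j = - ιn (q j)

  v0∈Δ : ∀ {n} (q : Vector ℕ n) → InP (Δ q) (v0 q)
  v0∈Δ q = coords⇒dil q 1ℚ (v0 q) (1ℚ , 0≤1 , eq , nn)
    where
    eq : 1ℚ * Nq q ≡ 1ℚ - ∑ℚ (v0 q)
    eq = trans (lem (Σq q)) (cong (λ z → 1ℚ - z) (sym (∑-neg (λ i → ιn (q i)))))
      where lem : ∀ s → 1ℚ * (1ℚ + s) ≡ 1ℚ - (- s)
            lem = solve-∀ ℚring
    nn : ∀ j → 0ℚ ≤ v0 q j + ιn (q j) * 1ℚ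
    nn j = subst (0ℚ ≤_) (sym (lem (ιn (q j)))) ℚP.≤-refl
      where lem : ∀ a → - a + a * 1ℚ ≡ 0ℚ
            lem = solve-∀ ℚring

  dot-e : ∀ {n} (k : Fin n) y → dot (e k) y ≡ y k
  dot-e k y = trans (∑-cong (λ j → ℚP.*-comm (e k j) (y j))) (sel-e y k)

  dot-v0 : ∀ {n} (q : Vector ℕ n) y → dot (v0 q) y ≡ - L q y
  dot-v0 q y = trans (∑-cong (λ j → lem (ιn (q j)) (y j))) (∑-neg (λ j → ιn (q j) * y j))
    where lem : ∀ a b → - a * b ≡ - (a * b)
          lem = solve-∀ ℚring

  -- The polar of Δ_q is { y | y_i ≥ -1 for all i, L_q y ≤ 1 }: necessity is
  -- pairing with the vertices, sufficiency is the identity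
  --   ⟨x , y⟩ + 1 = ∑ (x_j + q_j t_0)(y_j + 1) + t_0 (1 - L_q y)
  -- for x written in the coordinates of DilCoords.
  polar→ : ∀ {n} (q : Vector ℕ n) y → InPolar (Δ q) y → (∀ i → - 1ℚ ≤ y i) × (L q y ≤ 1ℚ)
  polar→ q y pol = (λ i → subst (- 1ℚ ≤_) (dot-e i y) (pol (e i) (e∈Δ q i))) ,
    ≤-by (dot (v0 q) y + 1ℚ) (trans (lem (L q y)) (cong (_+ 1ℚ) (sym (dot-v0 q y))))
         (subst (0ℚ ≤_) (lem2 (dot (v0 q) y)) (≤→0≤ (pol (v0 q) (v0∈Δ q))))
    where lem : ∀ a → 1ℚ - a ≡ - a + 1ℚ
          lem = solve-∀ ℚring
          lem2 : ∀ a → a - (- 1ℚ) ≡ a + 1ℚ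
          lem2 = solve-∀ ℚring

  polar←h : ∀ {n} (q : Vector ℕ n) y → (∀ i → - 1ℚ ≤ y i) → L q y ≤ 1ℚ → ∀ x → DilCoords q 1ℚ x → - 1ℚ ≤ dot x y
  polar←h q y lb Lle x (t0 , t0nn , eq , cnn) = ≤-by E eqE nnE
    where
    s : Pt _
    s j = x j + ιn (q j) * t0
    E : ℚ
    E = ∑ℚ (λ j → s j * (y j + 1ℚ)) + t0 * (1ℚ - L q y)
    nnE : 0ℚ ≤ E
    nnE = 0≤+ (∑-nonneg (λ j → 0≤* (cnn j) (subst (0ℚ ≤_) (lem1 (y j)) (≤→0≤ (lb j)))))
              (0≤* t0nn (≤→0≤ Lle))
      where lem1 : ∀ a → a - (- 1ℚ) ≡ a + 1ℚ
            lem1 = solve-∀ ℚring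
    sumS : ∑ℚ (λ j → s j * (y j + 1ℚ)) ≡ dot x y + t0 * L q y + ∑ℚ x + Σq q * t0
    sumS = begin
      ∑ℚ (λ j → s j * (y j + 1ℚ))
        ≡⟨ ∑-cong (λ j → lem (x j) (ιn (q j)) t0 (y j)) ⟩
      ∑ℚ (λ j → x j * y j + t0 * (ιn (q j) * y j) + x j + ιn (q j) * t0)
        ≡⟨ ∑-+ (λ j → x j * y j + t0 * (ιn (q j) * y j) + x j) (λ j → ιn (q j) * t0) ⟩
      ∑ℚ (λ j → x j * y j + t0 * (ιn (q j) * y j) + x j) + ∑ℚ (λ j → ιn (q j) * t0)
        ≡⟨ cong₂ _+_ (∑-+ (λ j → x j * y j + t0 * (ιn (q j) * y j)) x) (∑-*ʳ t0 (λ j → ιn (q j))) ⟩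
      ∑ℚ (λ j → x j * y j + t0 * (ιn (q j) * y j)) + ∑ℚ x + Σq q * t0
        ≡⟨ cong (λ z → z + ∑ℚ x + Σq q * t0) (trans (∑-+ (λ j → x j * y j) (λ j → t0 * (ιn (q j) * y j))) (cong (λ z → dot x y + z) (∑-* t0 (λ j → ιn (q j) * y j)))) ⟩
      dot x y + t0 * L q y + ∑ℚ x + Σq q * t0 ∎
      where open ≡-Reasoning
            lem : ∀ a b c d → (a + b * c) * (d + 1ℚ) ≡ a * d + c * (b * d) + a + b * c
            lem = solve-∀ ℚring
    eqE : dot x y - (- 1ℚ) ≡ E
    eqE = sym (begin
      E ≡⟨ cong (λ z → z + t0 * (1ℚ - L q y)) sumS ⟩
      dot x y + t0 * L q y + ∑ℚ x + Σq q * t0 + t0 * (1ℚ - L q y) ≡⟨ lem (dot x y) t0 (L q y) (∑ℚ x) (Σq q) ⟩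
      dot x y + (t0 * (1ℚ + Σq q) + ∑ℚ x) ≡⟨ cong (λ z → dot x y + (z + ∑ℚ x)) eq ⟩
      dot x y + (1ℚ - ∑ℚ x + ∑ℚ x) ≡⟨ lem2 (dot x y) (∑ℚ x) ⟩
      dot x y - (- 1ℚ) ∎)
      where open ≡-Reasoning
            lem : ∀ d t l sx s → d + t * l + sx + s * t + t * (1ℚ - l) ≡ d + (t * (1ℚ + s) + sx)
            lem = solve-∀ ℚring
            lem2 : ∀ d sx → d + (1ℚ - sx + sx) ≡ d - (- 1ℚ)
            lem2 = solve-∀ ℚring

  polar← : ∀ {n} (q : Vector ℕ n) y → (∀ i → - 1ℚ ≤ y i) → L q y ≤ 1ℚ → InPolar (Δ q) y
  polar← q y lb Lle x xin = polar←h q y lb Lle x (dil⇒coords q 1ℚ x xin)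

  ∑ℕ : ∀ {m} → (Fin m → ℕ) → ℕ
  ∑ℕ {zero} f = 0
  ∑ℕ {suc m} f = f zero ℕ.+ ∑ℕ (f ∘ suc)

  ιn∑ : ∀ {m} (f : Fin m → ℕ) → ιn (∑ℕ f) ≡ ∑ℚ (λ i → ιn (f i))
  ιn∑ {zero} f = refl
  ιn∑ {suc m} f = trans (ιn+ (f zero) (∑ℕ (f ∘ suc))) (cong (λ z → ιn (f zero) + z) (ιn∑ (f ∘ suc)))

  Nq≡ : ∀ {n} (q : Vector ℕ n) → Nq q ≡ ιn (suc (∑ℕ q))
  Nq≡ q = sym (trans (ιn-suc (∑ℕ q)) (cong (λ z → 1ℚ + z) (ιn∑ q)))

  0<Nq : ∀ {n} (q : Vector ℕ n) → 0ℚ < Nq q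
  0<Nq q = subst (0ℚ <_) (sym (Nq≡ q)) (0<ιn {suc (∑ℕ q)} (ℕ.s≤s ℕ.z≤n))

  1≤Nq : ∀ {n} (q : Vector ℕ n) → 1ℚ ≤ Nq q
  1≤Nq q = subst (1ℚ ≤_) (sym (Nq≡ q)) (1≤ιn {suc (∑ℕ q)} (ℕ.s≤s ℕ.z≤n))

  mid-lo : ∀ lo x z → lo ≤ x → lo ≤ z → lo ≡ ((ℤ.+ 1) / 2) * (x + z) → x ≡ lo
  mid-lo lo x z p q eq = trans (lem3 x lo) (trans (cong (_+ lo) A≡0) (ℚP.+-identityˡ lo))
    where
    A≡0 : x - lo ≡ 0ℚ
    A≡0 = ℚP.≤-antisym (subst ((x - lo) ≤_) sum0 (ℚP.≤-trans (ℚP.≤-reflexive (sym (ℚP.+-identityʳ _))) (ℚP.+-monoʳ-≤ (x - lo) (≤→0≤ q)))) (≤→0≤ p)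
      where
      sum0 : (x - lo) + (z - lo) ≡ 0ℚ
      sum0 = trans (lem x z lo) (trans (cong (λ w → (ℤ.+ 2 / 1) * (w - lo)) (sym eq)) (lem2 lo))
        where lem : ∀ x z lo → (x - lo) + (z - lo) ≡ (ℤ.+ 2 / 1) * (((ℤ.+ 1) / 2) * (x + z) - lo)
              lem = solve-∀ ℚring
              lem2 : ∀ lo → (ℤ.+ 2 / 1) * (lo - lo) ≡ 0ℚ
              lem2 = solve-∀ ℚring
    lem3 : ∀ x lo → x ≡ x - lo + lo
    lem3 = solve-∀ ℚring

  mid-hi : ∀ hi x z → x ≤ hi → z ≤ hi → hi ≡ ((ℤ.+ 1) / 2) * (x + z) → x ≡ hi
  mid-hi hi x z p q eq = trans (lem x) (trans (cong -_ r) (sym (lem hi)))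
    where
    r : - x ≡ - hi
    r = mid-lo (- hi) (- x) (- z) (ℚP.neg-antimono-≤ p) (ℚP.neg-antimono-≤ q)
          (trans (cong -_ eq) (lem2 x z))
      where lem2 : ∀ x z → - (((ℤ.+ 1) / 2) * (x + z)) ≡ ((ℤ.+ 1) / 2) * (- x + - z)
            lem2 = solve-∀ ℚring
    lem : ∀ x → x ≡ - - x
    lem = solve-∀ ℚring

  perturb : ∀ {n} (P : LPoly n) y → PolarVertex P y → (d : Pt n) (δ : ℚ) →
            InPolar P (λ i → y i + δ * d i) → InPolar P (λ i → y i - δ * d i) → ∀ k → δ * d k ≡ 0ℚ
  perturb P y (pol , ext) d δ pa pb k =
    trans (lem1 (y k) δ (d k)) (trans (cong (λ w → ((ℤ.+ 1) / 2) * (w - (y k - δ * d k))) eqk) (lem2 (y k - δ * d k)))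
    where
    mid : ∀ j → y j ≡ midpoint (λ i → y i + δ * d i) (λ i → y i - δ * d i) j
    mid j = lem (y j) δ (d j)
      where lem : ∀ a b c → a ≡ ((ℤ.+ 1) / 2) * ((a + b * c) + (a - b * c))
            lem = solve-∀ ℚring
    eqk : y k + δ * d k ≡ y k - δ * d k
    eqk = ext _ _ pa pb mid k
    lem1 : ∀ a b c → b * c ≡ ((ℤ.+ 1) / 2) * ((a + b * c) - (a - b * c))
    lem1 = solve-∀ ℚring
    lem2 : ∀ a → ((ℤ.+ 1) / 2) * (a - a) ≡ 0ℚ
    lem2 = solve-∀ ℚring

  minus-one-except : ∀ {n} (a : Pt n) k → (∀ i → i ≢ k → a i ≡ - 1ℚ) → ∀ i → a i ≡ - 1ℚ + (a k + 1ℚ) * e k i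
  minus-one-except a k h i with i FP.≟ k
  ... | yes refl = trans (lem (a i)) (cong (λ w → - 1ℚ + (a i + 1ℚ) * w) (sym (e-diag i)))
    where lem : ∀ x → x ≡ - 1ℚ + (x + 1ℚ) * 1ℚ
          lem = solve-∀ ℚring
  ... | no ne = trans (h i ne) (trans (lem (a k)) (cong (λ w → - 1ℚ + (a k + 1ℚ) * w) (sym (e-off k i (λ eq → ne (sym eq))))))
    where lem : ∀ x → - 1ℚ ≡ - 1ℚ + (x + 1ℚ) * 0ℚ
          lem = solve-∀ ℚring

  u-dominates : ∀ {n} (u : Pt n) → (∀ i → 0ℚ ≤ u i) → ∀ i j → 0ℚ ≤ u i - u j * e j i
  u-dominates u nn i j with i FP.≟ j
  ... | yes refl = subst (0ℚ ≤_) (sym (trans (cong (λ w → u i - u i * w) (e-diag i)) (lem (u i)))) ℚP.≤-refl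
    where lem : ∀ a → a - a * 1ℚ ≡ 0ℚ
          lem = solve-∀ ℚring
  ... | no ne = subst (0ℚ ≤_) (sym (trans (cong (λ w → u i - u j * w) (e-off j i (λ eq → ne (sym eq)))) (lem (u i) (u j)))) (nn i)
    where lem : ∀ a b → a - b * 0ℚ ≡ a
          lem = solve-∀ ℚring

  ≢→< : ∀ {a b} → a ≤ b → a ≢ b → a < b
  ≢→< {a} {b} p ne = h (b ℚP.≤? a)
    where
    h : Dec (b ≤ a) → a < b
    h (yes q) = ⊥-elim (ne (ℚP.≤-antisym p q))
    h (no q) = ℚP.≰⇒> q

  -- For positive weights, 0 is an interior point of Δ_q: with ε = 1/N_q the
  -- points ±ε e_j lie in Δ_q.
  zero-interior : ∀ {n} (q : Vector ℕ n) → (∀ i → 0 ℕ.< q i) → ZeroInInterior (Δ q)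
  zero-interior q qpos = zi (inv (Nq q) (0<Nq q))
    where
   zi : Σ ℚ (λ u → 0ℚ < u × Nq q * u ≡ 1ℚ) → ZeroInInterior (Δ q)
   zi (ε , εpos , εN) = ε , εpos , (λ j → pos j , neg j)
    where
    εnn : 0ℚ ≤ ε
    εnn = ℚP.<⇒≤ εpos
    ε≤1 : 0ℚ ≤ 1ℚ - ε
    ε≤1 = 0≤-by (ε * (Nq q - 1ℚ)) (trans (cong (_- ε) (sym εN)) (lem ε (Nq q))) (0≤* εnn (≤→0≤ (1≤Nq q)))
      where lem : ∀ e N → N * e - e ≡ e * (N - 1ℚ)
            lem = solve-∀ ℚring
    sumS : ∀ (c : ℚ) j → ∑ℚ (scale c (e j)) ≡ c
    sumS c j = trans (∑-* c (e j)) (trans (cong (c *_) (∑e j)) (ℚP.*-identityʳ c))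
    pos : ∀ j → InP (Δ q) (scale ε (e j))
    pos j = coords⇒dil q 1ℚ (scale ε (e j)) (ε * (1ℚ - ε) , 0≤* εnn ε≤1 , eq , co)
      where
      eq : ε * (1ℚ - ε) * Nq q ≡ 1ℚ - ∑ℚ (scale ε (e j))
      eq = trans (lem ε (Nq q)) (trans (cong (λ z → (1ℚ - ε) * z) εN)
             (trans (ℚP.*-identityʳ (1ℚ - ε)) (cong (λ z → 1ℚ - z) (sym (sumS ε j)))))
        where lem : ∀ e N → e * (1ℚ - e) * N ≡ (1ℚ - e) * (N * e)
              lem = solve-∀ ℚring
      co : ∀ i → 0ℚ ≤ scale ε (e j) i + ιn (q i) * (ε * (1ℚ - ε))
      co i = 0≤+ (0≤* εnn (e-nonneg j i)) (0≤* (0≤ιn (q i)) (0≤* εnn ε≤1))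
    neg : ∀ j → InP (Δ q) (scale (- ε) (e j))
    neg j = coords⇒dil q 1ℚ (scale (- ε) (e j)) (ε * (1ℚ + ε) , 0≤* εnn (0≤+ 0≤1 εnn) , eq , co)
      where
      eq : ε * (1ℚ + ε) * Nq q ≡ 1ℚ - ∑ℚ (scale (- ε) (e j))
      eq = trans (lem ε (Nq q)) (trans (cong (λ z → (1ℚ + ε) * z) εN)
             (trans (lem2 ε) (cong (λ z → 1ℚ - z) (sym (sumS (- ε) j)))))
        where lem : ∀ e N → e * (1ℚ + e) * N ≡ (1ℚ + e) * (N * e)
              lem = solve-∀ ℚring
              lem2 : ∀ e → (1ℚ + e) * 1ℚ ≡ 1ℚ - (- e)
              lem2 = solve-∀ ℚring
      co : ∀ i → 0ℚ ≤ scale (- ε) (e j) i + ιn (q i) * (ε * (1ℚ + ε))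
      co i = 0≤-by (ε * ((ιn (q i) - e j i) + ιn (q i) * ε)) (lem ε (e j i) (ιn (q i)))
               (0≤* εnn (0≤+ (≤→0≤ (ℚP.≤-trans (e-≤1 j i) (1≤ιn (qpos i)))) (0≤* (0≤ιn (q i)) εnn)))
        where lem : ∀ e x a → - e * x + a * (e * (1ℚ + e)) ≡ e * ((a - x) + a * e)
              lem = solve-∀ ℚring

  y+1 : ∀ a → a - (- 1ℚ) ≡ a + 1ℚ
  y+1 = solve-∀ ℚring

  L-balanced-direction : ∀ {n} (q : Vector ℕ n) k l →
        L q (λ i → ιn (q l) * e k i - ιn (q k) * e l i) ≡ 0ℚ
  L-balanced-direction q k l = begin
    ∑ℚ (λ i → ιn (q i) * (ιn (q l) * e k i - ιn (q k) * e l i))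
      ≡⟨ ∑-cong (λ i → lem (ιn (q i)) (ιn (q l)) (e k i) (ιn (q k)) (e l i)) ⟩
    ∑ℚ (λ i → ιn (q l) * (ιn (q i) * e k i) - ιn (q k) * (ιn (q i) * e l i))
      ≡⟨ ∑-sub (λ i → ιn (q l) * (ιn (q i) * e k i)) (λ i → ιn (q k) * (ιn (q i) * e l i)) ⟩
    ∑ℚ (λ i → ιn (q l) * (ιn (q i) * e k i)) - ∑ℚ (λ i → ιn (q k) * (ιn (q i) * e l i))
      ≡⟨ cong₂ _-_ (∑-* (ιn (q l)) (λ i → ιn (q i) * e k i)) (∑-* (ιn (q k)) (λ i → ιn (q i) * e l i)) ⟩
    ιn (q l) * L q (e k) - ιn (q k) * L q (e l)
      ≡⟨ cong₂ (λ a b → ιn (q l) * a - ιn (q k) * b) (L-e q k) (L-e q l) ⟩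
    ιn (q l) * ιn (q k) - ιn (q k) * ιn (q l)
      ≡⟨ lem2 (ιn (q l)) (ιn (q k)) ⟩
    0ℚ ∎
    where open ≡-Reasoning
          lem : ∀ a b c d f → a * (b * c - d * f) ≡ b * (a * c) - d * (a * f)
          lem = solve-∀ ℚring
          lem2 : ∀ a b → a * b - b * a ≡ 0ℚ
          lem2 = solve-∀ ℚring

  -- Let y be a vertex and u = y + 1 ≥ 0.  If
  -- two coordinates y_k, y_l were > -1, perturbing along q_l e_k - q_k e_l keeps
  -- y in the polar on both sides, contradicting extremality; if L_q y < 1,
  -- perturbing along e_k does.  Hence y = -1 + u_k e_k with q_k u_k = N_q, so y is
  -- a lattice point exactly when q_k ∣ N_q (or y = (-1,…,-1)).
  module PolarVertexLattice {n} (q : Vector ℕ n) (qpos : ∀ i → 0 ℕ.< q i) (y : Pt n) (pv : PolarVertex (Δ q) y) where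
    pol : InPolar (Δ q) y
    pol = proj₁ pv
    lb : ∀ i → (- 1ℚ) ≤ y i
    lb = proj₁ (polar→ q y pol)
    Lle : L q y ≤ 1ℚ
    Lle = proj₂ (polar→ q y pol)
    u : Pt n
    u i = y i + 1ℚ
    unn : ∀ i → 0ℚ ≤ u i
    unn i = subst (0ℚ ≤_) (y+1 (y i)) (≤→0≤ (lb i))
    upos : ∀ i → y i ≢ (- 1ℚ) → 0ℚ < u i
    upos i ne = ≢→< (unn i) (λ eq → ne (lem (y i) eq))
      where lem : ∀ a → 0ℚ ≡ a + 1ℚ → a ≡ (- 1ℚ)
            lem a eq = trans (l1 a) (trans (cong (_- 1ℚ) (sym eq)) refl)
              where l1 : ∀ a → a ≡ (a + 1ℚ) - 1ℚ
                    l1 = solve-∀ ℚring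

    module _ (k : Fin n) (yk : y k ≢ (- 1ℚ)) where
      ukpos : 0ℚ < u k
      ukpos = upos k yk

      -- If y_l > -1 for some l ≠ k, move y by ±δ (q_l e_k - q_k e_l) with
      -- δ = u_k u_l / (q_k u_k + q_l u_l): both points stay in the polar.
      single-free-coordinate : ∀ l → l ≢ k → y l ≢ (- 1ℚ) → ⊥
      single-free-coordinate l lk yl = ℚP.<-irrefl (sym dk0) δqpos
        where
        ulpos : 0ℚ < u l
        ulpos = upos l yl
        D : ℚ
        D = ιn (q k) * u k + ιn (q l) * u l
        Dpos : 0ℚ < D
        Dpos = subst (_< D) (ℚP.+-identityʳ 0ℚ) (ℚP.+-mono-<-≤ (0<* (0<ιn (qpos k)) ukpos) (0≤* (0≤ιn (q l)) (unn l)))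
        w : ℚ
        w = proj₁ (inv D Dpos)
        wpos : 0ℚ < w
        wpos = proj₁ (proj₂ (inv D Dpos))
        Dw : D * w ≡ 1ℚ
        Dw = proj₂ (proj₂ (inv D Dpos))
        wnn : 0ℚ ≤ w
        wnn = ℚP.<⇒≤ wpos
        δ : ℚ
        δ = u k * u l * w
        δpos : 0ℚ < δ
        δpos = 0<* (0<* ukpos ulpos) wpos
        δnn : 0ℚ ≤ δ
        δnn = ℚP.<⇒≤ δpos
        d : Pt n
        d i = ιn (q l) * e k i - ιn (q k) * e l i
        Ld : L q d ≡ 0ℚ
        Ld = L-balanced-direction q k l
        ul-δqk : u l - δ * ιn (q k) ≡ u l * w * (ιn (q l) * u l)
        ul-δqk = trans (cong (λ z → z - δ * ιn (q k)) (sym (ℚP.*-identityʳ (u l)))) (trans (cong (λ z → u l * z - δ * ιn (q k)) (sym Dw))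
                       (lem (y l) (y k) w (ιn (q k)) (ιn (q l))))
          where lem : ∀ yl yk w a b → (yl + 1ℚ) * ((a * (yk + 1ℚ) + b * (yl + 1ℚ)) * w) - (yk + 1ℚ) * (yl + 1ℚ) * w * a
                                       ≡ (yl + 1ℚ) * w * (b * (yl + 1ℚ))
                lem = solve-∀ ℚring
        uk-δql : u k - δ * ιn (q l) ≡ u k * w * (ιn (q k) * u k)
        uk-δql = trans (cong (λ z → z - δ * ιn (q l)) (sym (ℚP.*-identityʳ (u k)))) (trans (cong (λ z → u k * z - δ * ιn (q l)) (sym Dw))
                       (lem (y l) (y k) w (ιn (q k)) (ιn (q l))))
          where lem : ∀ yl yk w a b → (yk + 1ℚ) * ((a * (yk + 1ℚ) + b * (yl + 1ℚ)) * w) - (yk + 1ℚ) * (yl + 1ℚ) * w * b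
                                       ≡ (yk + 1ℚ) * w * (a * (yk + 1ℚ))
                lem = solve-∀ ℚring
        pa : InPolar (Δ q) (λ i → y i + δ * d i)
        pa = polar← q _ lbA LA
          where
          lbA : ∀ i → (- 1ℚ) ≤ y i + δ * d i
          lbA i = ≤-by (δ * ιn (q l) * e k i + (u i - u l * e l i) + e l i * (u l - δ * ιn (q k)))
                       (lem (y i) δ (ιn (q l)) (e k i) (ιn (q k)) (e l i) (u l))
                       (0≤+ (0≤+ (0≤* (0≤* δnn (0≤ιn (q l))) (e-nonneg k i)) (u-dominates u unn i l))
                            (0≤* (e-nonneg l i) (subst (0ℚ ≤_) (sym ul-δqk) (0≤* (0≤* (unn l) wnn) (0≤* (0≤ιn (q l)) (unn l))))))
            where lem : ∀ y δ a b c d f → y + δ * (a * b - c * d) - (- 1ℚ) ≡ δ * a * b + ((y + 1ℚ) - f * d) + d * (f - δ * c)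
                  lem = solve-∀ ℚring
          LA : L q (λ i → y i + δ * d i) ≤ 1ℚ
          LA = subst (_≤ 1ℚ) (sym (trans (L-lin q y d δ) (trans (cong (λ z → L q y + δ * z) Ld) (lem (L q y) δ)))) Lle
            where lem : ∀ a b → a + b * 0ℚ ≡ a
                  lem = solve-∀ ℚring
        pb : InPolar (Δ q) (λ i → y i - δ * d i)
        pb = polar← q _ lbB LB
          where
          lbB : ∀ i → (- 1ℚ) ≤ y i - δ * d i
          lbB i = ≤-by (δ * ιn (q k) * e l i + (u i - u k * e k i) + e k i * (u k - δ * ιn (q l)))
                       (lem (y i) δ (ιn (q l)) (e k i) (ιn (q k)) (e l i) (u k))
                       (0≤+ (0≤+ (0≤* (0≤* δnn (0≤ιn (q k))) (e-nonneg l i)) (u-dominates u unn i k))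
                            (0≤* (e-nonneg k i) (subst (0ℚ ≤_) (sym uk-δql) (0≤* (0≤* (unn k) wnn) (0≤* (0≤ιn (q k)) (unn k))))))
            where lem : ∀ y δ a b c d f → y - δ * (a * b - c * d) - (- 1ℚ) ≡ δ * c * d + ((y + 1ℚ) - f * b) + b * (f - δ * a)
                  lem = solve-∀ ℚring
          LB : L q (λ i → y i - δ * d i) ≤ 1ℚ
          LB = subst (_≤ 1ℚ) (sym (trans (∑-cong (λ i → lem0 (ιn (q i)) (y i) δ (d i))) (trans (L-lin q y d (- δ)) (trans (cong (λ z → L q y + - δ * z) Ld) (lem (L q y) δ))))) Lle
            where lem : ∀ a b → a + - b * 0ℚ ≡ a
                  lem = solve-∀ ℚring
                  lem0 : ∀ a b c d → a * (b - c * d) ≡ a * (b + - c * d)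
                  lem0 = solve-∀ ℚring
        dk0 : δ * d k ≡ 0ℚ
        dk0 = perturb (Δ q) y pv d δ pa pb k
        δqpos : 0ℚ < δ * d k
        δqpos = subst (0ℚ <_) (sym (trans (cong₂ (λ a b → δ * (ιn (q l) * a - ιn (q k) * b)) (e-diag k) (e-off l k (λ eq → lk eq)))
                                   (lem δ (ιn (q l)) (ιn (q k)))))
                  (0<* δpos (0<ιn (qpos l)))
          where lem : ∀ a b c → a * (b * 1ℚ - c * 0ℚ) ≡ a * b
                lem = solve-∀ ℚring

      others-minus-one : ∀ l → l ≢ k → y l ≡ (- 1ℚ)
      others-minus-one l lk = h (y l ℚP.≟ (- 1ℚ))
        where h : Dec (y l ≡ (- 1ℚ)) → y l ≡ (- 1ℚ)
              h (yes p) = p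
              h (no yl) = ⊥-elim (single-free-coordinate l lk yl)

      -- If L_q y < 1, move y by ±δ e_k with δ = u_k σ / (σ + q_k u_k), σ = 1 - L_q y.
      on-facet : L q y ≢ 1ℚ → ⊥
      on-facet ne = ℚP.<-irrefl (sym dk0) δpos'
        where
        σ : ℚ
        σ = 1ℚ - L q y
        σpos : 0ℚ < σ
        σpos = <→0< (≢→< Lle ne)
        D : ℚ
        D = σ + ιn (q k) * u k
        Dpos : 0ℚ < D
        Dpos = 0<+ σpos (0≤* (0≤ιn (q k)) (unn k))
        w : ℚ
        w = proj₁ (inv D Dpos)
        wpos : 0ℚ < w
        wpos = proj₁ (proj₂ (inv D Dpos))
        Dw : D * w ≡ 1ℚ
        Dw = proj₂ (proj₂ (inv D Dpos))
        wnn : 0ℚ ≤ w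
        wnn = ℚP.<⇒≤ wpos
        δ : ℚ
        δ = u k * σ * w
        δpos : 0ℚ < δ
        δpos = 0<* (0<* ukpos σpos) wpos
        δnn : 0ℚ ≤ δ
        δnn = ℚP.<⇒≤ δpos
        La : L q (λ i → y i + δ * e k i) ≡ L q y + δ * ιn (q k)
        La = trans (L-lin q y (e k) δ) (cong (λ z → L q y + δ * z) (L-e q k))
        pa : InPolar (Δ q) (λ i → y i + δ * e k i)
        pa = polar← q _ lbA LA
          where
          lbA : ∀ i → (- 1ℚ) ≤ y i + δ * e k i
          lbA i = ≤-by ((y i + 1ℚ) + δ * e k i) (lem (y i) δ (e k i)) (0≤+ (unn i) (0≤* δnn (e-nonneg k i)))
            where lem : ∀ y d e → y + d * e - (- 1ℚ) ≡ (y + 1ℚ) + d * e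
                  lem = solve-∀ ℚring
          LA : L q (λ i → y i + δ * e k i) ≤ 1ℚ
          LA = ≤-by (σ * w * σ) eq (0≤* (0≤* (ℚP.<⇒≤ σpos) wnn) (ℚP.<⇒≤ σpos))
            where
            eq : 1ℚ - L q (λ i → y i + δ * e k i) ≡ σ * w * σ
            eq = trans (cong (λ z → 1ℚ - z) La)
                 (trans (lemA (L q y) δ (ιn (q k)))
                 (trans (cong (λ z → σ * z - δ * ιn (q k)) (sym Dw))
                        (lemB (L q y) (y k) w (ιn (q k)))))
              where lemA : ∀ l d a → 1ℚ - (l + d * a) ≡ (1ℚ - l) * 1ℚ - d * a
                    lemA = solve-∀ ℚring
                    lemB : ∀ l yk w a → (1ℚ - l) * (((1ℚ - l) + a * (yk + 1ℚ)) * w) - (yk + 1ℚ) * (1ℚ - l) * w * a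
                                        ≡ (1ℚ - l) * w * (1ℚ - l)
                    lemB = solve-∀ ℚring
        uk-δ : u k - δ ≡ u k * w * (ιn (q k) * u k)
        uk-δ = trans (cong (λ z → z - δ) (sym (ℚP.*-identityʳ (u k))))
               (trans (cong (λ z → u k * z - δ) (sym Dw)) (lem (L q y) (y k) w (ιn (q k))))
          where lem : ∀ l yk w a → (yk + 1ℚ) * (((1ℚ - l) + a * (yk + 1ℚ)) * w) - (yk + 1ℚ) * (1ℚ - l) * w
                                   ≡ (yk + 1ℚ) * w * (a * (yk + 1ℚ))
                lem = solve-∀ ℚring
        pb : InPolar (Δ q) (λ i → y i - δ * e k i)
        pb = polar← q _ lbB LB
          where
          lbB : ∀ i → (- 1ℚ) ≤ y i - δ * e k i
          lbB i = ≤-by ((u i - u k * e k i) + e k i * (u k - δ)) (lem (y i) δ (e k i) (u k))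
                    (0≤+ (u-dominates u unn i k) (0≤* (e-nonneg k i) (subst (0ℚ ≤_) (sym uk-δ) (0≤* (0≤* (unn k) wnn) (0≤* (0≤ιn (q k)) (unn k))))))
            where lem : ∀ y d e f → y - d * e - (- 1ℚ) ≡ ((y + 1ℚ) - f * e) + e * (f - d)
                  lem = solve-∀ ℚring
          LB : L q (λ i → y i - δ * e k i) ≤ 1ℚ
          LB = ℚP.≤-trans (≤-by (δ * ιn (q k)) eq (0≤* δnn (0≤ιn (q k)))) Lle
            where
            eq : L q y - L q (λ i → y i - δ * e k i) ≡ δ * ιn (q k)
            eq = trans (cong (λ z → L q y - z)
                        (trans (∑-cong (λ i → lem0 (ιn (q i)) (y i) δ (e k i)))
                        (trans (L-lin q y (e k) (- δ)) (cong (λ z → L q y + - δ * z) (L-e q k)))))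
                       (lem (L q y) δ (ιn (q k)))
              where lem0 : ∀ a b c d → a * (b - c * d) ≡ a * (b + - c * d)
                    lem0 = solve-∀ ℚring
                    lem : ∀ l d a → l - (l + - d * a) ≡ d * a
                    lem = solve-∀ ℚring
        dk0 : δ * e k k ≡ 0ℚ
        dk0 = perturb (Δ q) y pv (e k) δ pa pb k
        δpos' : 0ℚ < δ * e k k
        δpos' = subst (0ℚ <_) (sym (trans (cong (δ *_) (e-diag k)) (ℚP.*-identityʳ δ))) δpos

      L≡1 : L q y ≡ 1ℚ
      L≡1 = h (L q y ℚP.≟ 1ℚ)
        where h : Dec (L q y ≡ 1ℚ) → L q y ≡ 1ℚ
              h (yes p) = p
              h (no ne) = ⊥-elim (on-facet ne)

      yrep : ∀ i → y i ≡ (- 1ℚ) + u k * e k i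
      yrep = minus-one-except y k others-minus-one

      Lrep0 : L q y ≡ - Σq q + u k * ιn (q k)
      Lrep0 = trans (∑-cong (λ i → cong (ιn (q i) *_) (yrep i))) (L-rep q k (u k))

      key : ιn (q k) * u k ≡ Nq q
      key = trans (lem (ιn (q k)) (u k) (Σq q)) (cong (λ z → z + Σq q) (trans (sym Lrep0) L≡1))
        where
        lem : ∀ a u s → a * u ≡ (- s + u * a) + s
        lem = solve-∀ ℚring

      lattice-if-divides : q k ∣ suc (∑ℕ q) → IsLatticePoint y
      lattice-if-divides (divides c eqN) = z , zeq
        where
        ukc : u k ≡ ιn c
        ukc = *-cancel (0<ιn (qpos k))
                (trans key (trans (Nq≡ q) (trans (cong ιn eqN) (trans (ιn* c (q k)) (ℚP.*-comm (ιn c) (ιn (q k)))))))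
        z : ZPt n
        z i = ℤ.-[1+ 0 ] ℤ.+ (+ c) ℤ.* eZ k i
        zeq : ∀ i → y i ≡ ι (z i)
        zeq i = trans (yrep i) (trans (cong₂ (λ a b → (- 1ℚ) + a * b) ukc (eι k i))
                  (sym (trans (ι+ ℤ.-[1+ 0 ] ((+ c) ℤ.* eZ k i)) (cong (λ t → (- 1ℚ) + t) (ι* (+ c) (eZ k i))))))

    lattice-point : (∀ k → q k ∣ suc (∑ℕ q)) → IsLatticePoint y
    lattice-point qdiv = h (FP.all? (λ i → y i ℚP.≟ (- 1ℚ)))
      where
      h2 : ∃ (λ k → ¬ (y k ≡ (- 1ℚ))) → IsLatticePoint y
      h2 (k , yk) = lattice-if-divides k yk (qdiv k)
      h : Dec (∀ i → y i ≡ (- 1ℚ)) → IsLatticePoint y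
      h (yes all1) = (λ _ → ℤ.-[1+ 0 ]) , all1
      h (no nall) = h2 (FP.¬∀⟶∃¬ n (λ i → y i ≡ (- 1ℚ)) (λ i → y i ℚP.≟ (- 1ℚ)) nall)

  reflexive-of-divides : ∀ {n} (q : Vector ℕ n) → (∀ i → 0 ℕ.< q i) → (∀ k → q k ∣ suc (∑ℕ q)) → Reflexive (Δ q)
  reflexive-of-divides q qpos qdiv = zero-interior q qpos , (λ y pv → PolarVertexLattice.lattice-point q qpos y pv qdiv)

  Lmid : ∀ {n} (q : Vector ℕ n) (y a b : Pt n) → (∀ j → y j ≡ midpoint a b j) →
         L q y ≡ ((ℤ.+ 1) / 2) * (L q a + L q b)
  Lmid q y a b mid = trans (∑-cong (λ i → trans (cong (ιn (q i) *_) (mid i)) (lem (ιn (q i)) (a i) (b i))))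
    (trans (∑-* ((ℤ.+ 1) / 2) (λ i → ιn (q i) * a i + ιn (q i) * b i))
           (cong (((ℤ.+ 1) / 2) *_) (∑-+ (λ i → ιn (q i) * a i) (λ i → ιn (q i) * b i))))
    where lem : ∀ c a b → c * (((ℤ.+ 1) / 2) * (a + b)) ≡ ((ℤ.+ 1) / 2) * (c * a + c * b)
          lem = solve-∀ ℚring

  half-comm : ∀ a b → ((ℤ.+ 1) / 2) * (a + b) ≡ ((ℤ.+ 1) / 2) * (b + a)
  half-comm a b = cong (((ℤ.+ 1) / 2) *_) (ℚP.+-comm a b)

  -- Reflexivity criterion, necessity: the point -1 + (N_q / q_k) e_k is a vertex
  -- of the polar of Δ_q (its coordinates other than k are pinned at -1 and L_q is
  -- pinned at 1), so reflexivity makes N_q / q_k an integer.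
  module ReflexiveDivides {n} (q : Vector ℕ n) (k : Fin n) (qk : 0 ℕ.< q k) (R : Reflexive (Δ q)) where
    w : ℚ
    w = proj₁ (inv (ιn (q k)) (0<ιn qk))
    wpos : 0ℚ < w
    wpos = proj₁ (proj₂ (inv (ιn (q k)) (0<ιn qk)))
    qw : ιn (q k) * w ≡ 1ℚ
    qw = proj₂ (proj₂ (inv (ιn (q k)) (0<ιn qk)))
    U : ℚ
    U = Nq q * w
    qU : ιn (q k) * U ≡ Nq q
    qU = trans (lem (ιn (q k)) (Nq q) w) (trans (cong (Nq q *_) qw) (ℚP.*-identityʳ (Nq q)))
      where lem : ∀ a N w → a * (N * w) ≡ N * (a * w)
            lem = solve-∀ ℚring
    Unn : 0ℚ ≤ U
    Unn = 0≤* (ℚP.<⇒≤ (0<Nq q)) (ℚP.<⇒≤ wpos)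
    y : Pt n
    y i = (- 1ℚ) + U * e k i
    Ly : L q y ≡ 1ℚ
    Ly = trans (L-rep q k U) (trans (cong (λ z → - Σq q + z) (trans (ℚP.*-comm U (ιn (q k))) qU)) (lem (Σq q)))
      where lem : ∀ s → - s + (1ℚ + s) ≡ 1ℚ
            lem = solve-∀ ℚring
    pol : InPolar (Δ q) y
    pol = polar← q y (λ i → ≤-by (U * e k i) (lem (U * e k i)) (0≤* Unn (e-nonneg k i))) (ℚP.≤-reflexive Ly)
      where lem : ∀ a → - 1ℚ + a - (- 1ℚ) ≡ a
            lem = solve-∀ ℚring
    yoff : ∀ i → i ≢ k → y i ≡ (- 1ℚ)
    yoff i ne = trans (cong (λ z → (- 1ℚ) + U * z) (e-off k i (λ eq → ne (sym eq)))) (lem U)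
      where lem : ∀ u → - 1ℚ + u * 0ℚ ≡ - 1ℚ
            lem = solve-∀ ℚring
    -- Extremality: in a midpoint decomposition the coordinates i ≠ k and the value
    -- of L_q are pinned, which determines the k-th coordinate as well.
    ext : ∀ a b → InPolar (Δ q) a → InPolar (Δ q) b → (∀ j → y j ≡ midpoint a b j) → ∀ j → a j ≡ b j
    ext a b pa pb mid j = h (j FP.≟ k)
      where
      lba : ∀ i → - 1ℚ ≤ a i
      lba = proj₁ (polar→ q a pa)
      La : L q a ≤ 1ℚ
      La = proj₂ (polar→ q a pa)
      lbb : ∀ i → - 1ℚ ≤ b i
      lbb = proj₁ (polar→ q b pb)
      Lb : L q b ≤ 1ℚ
      Lb = proj₂ (polar→ q b pb)
      aoff : ∀ i → i ≢ k → a i ≡ (- 1ℚ)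
      aoff i ne = mid-lo (- 1ℚ) (a i) (b i) (lba i) (lbb i) (trans (sym (yoff i ne)) (mid i))
      boff : ∀ i → i ≢ k → b i ≡ (- 1ℚ)
      boff i ne = mid-lo (- 1ℚ) (b i) (a i) (lbb i) (lba i) (trans (sym (yoff i ne)) (trans (mid i) (half-comm (a i) (b i))))
      LyM : L q y ≡ ((ℤ.+ 1) / 2) * (L q a + L q b)
      LyM = Lmid q y a b mid
      La1 : L q a ≡ 1ℚ
      La1 = mid-hi 1ℚ (L q a) (L q b) La Lb (trans (sym Ly) LyM)
      Lb1 : L q b ≡ 1ℚ
      Lb1 = mid-hi 1ℚ (L q b) (L q a) Lb La (trans (sym Ly) (trans LyM (half-comm (L q a) (L q b))))
      Lrep : ∀ (c : Pt n) → (∀ i → i ≢ k → c i ≡ (- 1ℚ)) → L q c ≡ - Σq q + (c k + 1ℚ) * ιn (q k)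
      Lrep c off = trans (∑-cong (λ i → cong (ιn (q i) *_) (minus-one-except c k off i))) (L-rep q k (c k + 1ℚ))
      akbk : a k ≡ b k
      akbk = trans (lem (a k)) (trans (cong (_- 1ℚ) ab1) (sym (lem (b k))))
        where
        lem : ∀ x → x ≡ (x + 1ℚ) - 1ℚ
        lem = solve-∀ ℚring
        c1 : ιn (q k) * (a k + 1ℚ) ≡ ιn (q k) * (b k + 1ℚ)
        c1 = trans (ℚP.*-comm (ιn (q k)) (a k + 1ℚ))
             (trans (cancelS (trans (sym (Lrep a aoff)) (trans La1 (trans (sym Lb1) (Lrep b boff)))))
                    (ℚP.*-comm (b k + 1ℚ) (ιn (q k))))
          where cancelS : ∀ {x y} → - Σq q + x ≡ - Σq q + y → x ≡ y
                cancelS {x} {y} eq = trans (l x (Σq q)) (trans (cong (_+ Σq q) eq) (sym (l y (Σq q))))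
                  where l : ∀ x s → x ≡ - s + x + s
                        l = solve-∀ ℚring
        ab1 : a k + 1ℚ ≡ b k + 1ℚ
        ab1 = *-cancel (0<ιn qk) c1
      h : Dec (j ≡ k) → a j ≡ b j
      h (yes refl) = akbk
      h (no ne) = trans (aoff j ne) (sym (boff j ne))
    pv : PolarVertex (Δ q) y
    pv = pol , ext
    lat : IsLatticePoint y
    lat = proj₂ R y pv
    z : ZPt n
    z = proj₁ lat
    zk : y k ≡ ι (z k)
    zk = proj₂ lat k
    Uz : U ≡ ι (z k ℤ.+ + 1)
    Uz = trans (lem U) (trans (cong (_+ 1ℚ) (trans (cong (λ t → (- 1ℚ) + U * t) (sym (e-diag k))) zk)) (sym (ι+ (z k) (+ 1))))
      where lem : ∀ u → u ≡ (- 1ℚ + u * 1ℚ) + 1ℚ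
            lem = solve-∀ ℚring
    eqZ : + suc (∑ℕ q) ≡ + q k ℤ.* (z k ℤ.+ + 1)
    eqZ = ι-inj (trans (sym (Nq≡ q)) (trans (sym qU) (trans (cong (ιn (q k) *_) Uz) (sym (ι* (+ q k) (z k ℤ.+ + 1))))))
    divides-N : q k ∣ suc (∑ℕ q)
    divides-N = divides ℤ.∣ z k ℤ.+ + 1 ∣ (trans (cong ℤ.∣_∣ eqZ) (trans (ℤP.abs-* (+ q k) (z k ℤ.+ + 1)) (ℕP.*-comm (q k) _)))

  divides-of-reflexive : ∀ {n} (q : Vector ℕ n) k → 0 ℕ.< q k → Reflexive (Δ q) → q k ∣ suc (∑ℕ q)
  divides-of-reflexive q k qk R = ReflexiveDivides.divides-N q k qk R

  ∑ℕ-cong : ∀ {m} {f g : Fin m → ℕ} → (∀ i → f i ≡ g i) → ∑ℕ f ≡ ∑ℕ g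
  ∑ℕ-cong {zero} h = refl
  ∑ℕ-cong {suc m} h = cong₂ ℕ._+_ (h zero) (∑ℕ-cong (h ∘ suc))

  ∑ℕ-split : ∀ a b (f : Fin (a ℕ.+ b) → ℕ) → ∑ℕ f ≡ ∑ℕ (λ i → f (i ↑ˡ b)) ℕ.+ ∑ℕ (λ i → f (a ↑ʳ i))
  ∑ℕ-split zero b f = refl
  ∑ℕ-split (suc a) b f = trans (cong (f zero ℕ.+_) (∑ℕ-split a b (f ∘ suc))) (sym (ℕP.+-assoc (f zero) _ _))

  ∑ℕ-const : ∀ m c → ∑ℕ {m} (λ _ → c) ≡ m ℕ.* c
  ∑ℕ-const zero c = refl
  ∑ℕ-const (suc m) c = cong (c ℕ.+_) (∑ℕ-const m c)

  neg1< : ∀ {z} → ℤ.-[1+ 0 ] ℤ.< z → + 0 ℤ.≤ z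
  neg1< {+ n} _ = ℤ.+≤+ ℕ.z≤n
  neg1< { ℤ.-[1+ n ]} (ℤ.-<- ())

  module Concat {np m : ℕ} (p : Vector ℕ np) (rk : ℕ) where
    q : Vector ℕ (np ℕ.+ m)
    q = p VF.++ VF.replicate m rk
    qL : ∀ i → q (i ↑ˡ m) ≡ p i
    qL i = ++ˡ p (VF.replicate m rk) i
    qR : ∀ l → q (np ↑ʳ l) ≡ rk
    qR l = ++ʳ p (VF.replicate m rk) l
    ∑ℕq : ∑ℕ q ≡ ∑ℕ p ℕ.+ m ℕ.* rk
    ∑ℕq = trans (∑ℕ-split np m q) (cong₂ ℕ._+_ (∑ℕ-cong qL) (trans (∑ℕ-cong qR) (∑ℕ-const m rk)))
    Σqq : Σq q ≡ Σq p + ιn m * ιn rk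
    Σqq = trans (∑-split np m (λ i → ιn (q i)))
            (cong₂ _+_ (∑-cong (λ i → cong ιn (qL i))) (trans (∑-cong (λ l → cong ιn (qR l))) (∑-const {m} (ιn rk))))
    Nqq : Nq q ≡ Nq p + ιn m * ιn rk
    Nqq = trans (cong (λ z → 1ℚ + z) Σqq) (sym (ℚP.+-assoc 1ℚ (Σq p) (ιn m * ιn rk)))
    rk∣Np : 0 ℕ.< m → 0 ℕ.< rk → Reflexive (Δ q) → rk ∣ suc (∑ℕ p)
    rk∣Np mpos rkpos R = ∣m+n∣m⇒∣n h3 mdiv
      where
      k : Fin (np ℕ.+ m)
      k = np ↑ʳ lz
        where lz : Fin m
              lz = F.fromℕ< mpos
      h1 : q k ∣ suc (∑ℕ q)
      h1 = divides-of-reflexive q k (subst (0 ℕ.<_) (sym (qR _)) rkpos) R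
      h3 : rk ∣ m ℕ.* rk ℕ.+ suc (∑ℕ p)
      h3 = subst₂ _∣_ (qR _) (trans (cong suc ∑ℕq) (ℕP.+-comm (suc (∑ℕ p)) (m ℕ.* rk))) h1
      mdiv : rk ∣ m ℕ.* rk
      mdiv = divides m refl

  cancel< : ∀ {K a} → 0ℚ < K → 0ℚ < K * a → 0ℚ < a
  cancel< {K} {a} Kp h = ℚP.*-cancelˡ-<-nonNeg K {{ℚ.nonNegative (ℚP.<⇒≤ Kp)}} (subst (_< K * a) (sym (ℚP.*-zeroʳ K)) h)

  -- Suppose N_p = c·rk
  -- with c ≥ 1 (given by the reflexivity of Δ_q), and put K = c + m.  The lattice
  -- point w = (0,…,0,-1,…,-1) lies in c·Δ_q; decompose it as a sum of c lattice
  -- points x_i of Δ_q with coordinates t_0(i).  Comparing sums shows that in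
  -- each x_i the last block equals -rk·t_0(i) (the quantities T i l vanish), each
  -- last-block entry lies in [-1, 0], and the first block is ≥ 0, hence zero for
  -- i = 0.  Solving for x_0 gives c·(x_0)_l = -1 with (x_0)_l an integer, so c = 1.
  module IDPForcesEquality {np m : ℕ} (p : Vector ℕ np) (rk : ℕ) (mpos : 0 ℕ.< m) (rkpos : 0 ℕ.< rk)
               (plt : ∀ i → p i ℕ.< rk) (c' : ℕ) (eqc : suc (∑ℕ p) ≡ suc c' ℕ.* rk)
               (idp : IDP (Δ (Concat.q {np} {m} p rk))) where
    open Concat {np} {m} p rk
    l0 : Fin m
    l0 = F.fromℕ< mpos
    Kc : ℚ
    Kc = ιn (suc c')
    Km : ℚ
    Km = ιn m
    K : ℚ
    K = Kc + Km
    R : ℚ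
    R = ιn rk
    Kpos : 0ℚ < K
    Kpos = 0<+ (0<ιn {suc c'} (ℕ.s≤s ℕ.z≤n)) (0≤ιn m)
    Knn : 0ℚ ≤ K
    Knn = ℚP.<⇒≤ Kpos
    Rpos : 0ℚ < R
    Rpos = 0<ιn rkpos
    NpQ : Nq p ≡ Kc * R
    NpQ = trans (Nq≡ p) (trans (cong ιn eqc) (ιn* (suc c') rk))
    NqK : Nq q ≡ K * R
    NqK = trans Nqq (trans (cong (_+ Km * R) NpQ) (lem Kc Km R))
      where lem : ∀ a b r → a * r + b * r ≡ (a + b) * r
            lem = solve-∀ ℚring
    wr : ℚ
    wr = proj₁ (inv R Rpos)
    wrpos : 0ℚ < wr
    wrpos = proj₁ (proj₂ (inv R Rpos))
    Rw : R * wr ≡ 1ℚ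
    Rw = proj₂ (proj₂ (inv R Rpos))
    w : ZPt (np ℕ.+ m)
    w = VF._++_ {m = np} {n = m} (λ _ → + 0) (λ _ → ℤ.-[1+ 0 ])
    wL : ∀ i → ι (w (i ↑ˡ m)) ≡ 0ℚ
    wL i = cong ι (++ˡ {a = np} {b = m} (λ _ → + 0) (λ _ → ℤ.-[1+ 0 ]) i)
    wR : ∀ l → ι (w (np ↑ʳ l)) ≡ - 1ℚ
    wR l = cong ι (++ʳ (λ (_ : Fin np) → + 0) (λ (_ : Fin m) → ℤ.-[1+ 0 ]) l)
    ∑w : ∑ℚ (embed w) ≡ - Km
    ∑w = trans (∑-split np m (embed w))
          (trans (cong₂ _+_ (trans (∑-cong wL) (∑-0 {np})) (trans (∑-cong wR) (∑-const {m} (- 1ℚ)))) (lem Km))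
      where lem : ∀ k → 0ℚ + k * (- 1ℚ) ≡ - k
            lem = solve-∀ ℚring
    inDil : InDil (Δ q) (ι (+ suc c')) (embed w)
    inDil = coords⇒dil q (ι (+ suc c')) (embed w) (wr , ℚP.<⇒≤ wrpos , eq , split-ind {np} {m} (λ j → 0ℚ ≤ embed w j + ιn (q j) * wr) coL coR)
      where
      eq : wr * Nq q ≡ Kc - ∑ℚ (embed w)
      eq = trans (cong (wr *_) NqK) (trans (lem wr K R) (trans (cong (K *_) Rw)
             (trans (ℚP.*-identityʳ K) (trans (lem2 Kc Km) (cong (λ z → Kc - z) (sym ∑w))))))
        where lem : ∀ w k r → w * (k * r) ≡ k * (r * w)
              lem = solve-∀ ℚring
              lem2 : ∀ a b → a + b ≡ a - (- b)
              lem2 = solve-∀ ℚring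
      coL : ∀ i → 0ℚ ≤ embed w (i ↑ˡ m) + ιn (q (i ↑ˡ m)) * wr
      coL i = 0≤-by (ιn (q (i ↑ˡ m)) * wr) (trans (cong (_+ ιn (q (i ↑ˡ m)) * wr) (wL i)) (ℚP.+-identityˡ _))
                (0≤* (0≤ιn (q (i ↑ˡ m))) (ℚP.<⇒≤ wrpos))
      coR : ∀ l → 0ℚ ≤ embed w (np ↑ʳ l) + ιn (q (np ↑ʳ l)) * wr
      coR l = 0≤-by 0ℚ (trans (cong₂ (λ a b → a + ιn b * wr) (wR l) (qR l)) (trans (cong (λ z → - 1ℚ + z) Rw) refl)) ℚP.≤-refl
    xs : Fin (suc c') → ZPt (np ℕ.+ m)
    xs = proj₁ (idp c' w inDil)
    xin : ∀ i → InP (Δ q) (embed (xs i))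
    xin = proj₁ (proj₂ (idp c' w inDil))
    xsum : ∀ j → ∑ℤ (λ i → xs i j) ≡ w j
    xsum = proj₂ (proj₂ (idp c' w inDil))
    X : Fin (suc c') → Fin (np ℕ.+ m) → ℚ
    X i j = ι (xs i j)
    ch : ∀ i → DilCoords q 1ℚ (embed (xs i))
    ch i = dil⇒coords q 1ℚ (embed (xs i)) (xin i)
    t0 : Fin (suc c') → ℚ
    t0 i = proj₁ (ch i)
    t0nn : ∀ i → 0ℚ ≤ t0 i
    t0nn i = proj₁ (proj₂ (ch i))
    teq : ∀ i → t0 i * Nq q ≡ 1ℚ - ∑ℚ (X i)
    teq i = proj₁ (proj₂ (proj₂ (ch i)))
    cnn : ∀ i j → 0ℚ ≤ X i j + ιn (q j) * t0 i
    cnn i = proj₂ (proj₂ (proj₂ (ch i)))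
    A : Fin (suc c') → ℚ
    A i = t0 i * Nq q
    sumX : ∀ j → ∑ℚ (λ i → X i j) ≡ ι (w j)
    sumX j = trans (sym (ι∑ (λ i → xs i j))) (cong ι (xsum j))
    -- T i l = K (x_i)_l + t_0(i) N_q is nonnegative and sums to 0 over i, so it vanishes.
    T : Fin (suc c') → Fin m → ℚ
    T i l = K * X i (np ↑ʳ l) + A i
    Tnn : ∀ i l → 0ℚ ≤ T i l
    Tnn i l = 0≤-by (K * (X i (np ↑ʳ l) + ιn (q (np ↑ʳ l)) * t0 i)) eqT (0≤* Knn (cnn i (np ↑ʳ l)))
      where
      eqT : T i l ≡ K * (X i (np ↑ʳ l) + ιn (q (np ↑ʳ l)) * t0 i)
      eqT = trans (cong (λ z → K * X i (np ↑ʳ l) + t0 i * z) NqK)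
            (trans (lem K (X i (np ↑ʳ l)) (t0 i) R) (cong (λ z → K * (X i (np ↑ʳ l) + ιn z * t0 i)) (sym (qR l))))
        where lem : ∀ k x t r → k * x + t * (k * r) ≡ k * (x + r * t)
              lem = solve-∀ ℚring
    ΣA : ∑ℚ A ≡ K
    ΣA = begin
      ∑ℚ A ≡⟨ ∑-cong teq ⟩
      ∑ℚ (λ i → 1ℚ - ∑ℚ (X i)) ≡⟨ ∑-sub (λ _ → 1ℚ) (λ i → ∑ℚ (X i)) ⟩
      ∑ℚ {suc c'} (λ _ → 1ℚ) - ∑ℚ (λ i → ∑ℚ (X i)) ≡⟨ cong₂ _-_ (trans (∑-const {suc c'} 1ℚ) (ℚP.*-identityʳ Kc)) (∑-swap X) ⟩
      Kc - ∑ℚ (λ j → ∑ℚ (λ i → X i j)) ≡⟨ cong (λ z → Kc - z) (trans (∑-cong sumX) ∑w) ⟩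
      Kc - (- Km) ≡⟨ lem Kc Km ⟩
      K ∎
      where open ≡-Reasoning
            lem : ∀ a b → a - (- b) ≡ a + b
            lem = solve-∀ ℚring
    ΣT : ∀ l → ∑ℚ (λ i → T i l) ≡ 0ℚ
    ΣT l = trans (∑-+ (λ i → K * X i (np ↑ʳ l)) A)
           (trans (cong₂ _+_ (trans (∑-* K (λ i → X i (np ↑ʳ l))) (cong (K *_) (trans (sumX (np ↑ʳ l)) (wR l)))) ΣA)
                  (lem K))
      where lem : ∀ k → k * (- 1ℚ) + k ≡ 0ℚ
            lem = solve-∀ ℚring
    T0 : ∀ i l → T i l ≡ 0ℚ
    T0 i l = ∑-zero-each (λ i → Tnn i l) (ΣT l) i
    XRt : ∀ i l → X i (np ↑ʳ l) + R * t0 i ≡ 0ℚ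
    XRt i l = *-cancel Kpos (trans (trans (lem K (X i (np ↑ʳ l)) R (t0 i)) (trans (cong (λ z → K * X i (np ↑ʳ l) + t0 i * z) (sym NqK)) (T0 i l))) (sym (ℚP.*-zeroʳ K)))
      where lem : ∀ k x r t → k * (x + r * t) ≡ k * x + t * (k * r)
            lem = solve-∀ ℚring
    Xle0 : ∀ i l → 0ℚ ≤ - X i (np ↑ʳ l)
    Xle0 i l = 0≤-by (R * t0 i) (trans (lem (X i (np ↑ʳ l)) (R * t0 i)) (trans (cong (λ z → - z + R * t0 i) (XRt i l)) (ℚP.+-identityˡ _)))
                 (0≤* (ℚP.<⇒≤ Rpos) (t0nn i))
      where lem : ∀ x y → - x ≡ - (x + y) + y
            lem = solve-∀ ℚring
    Xge : ∀ i l → - X i (np ↑ʳ l) ≤ 1ℚ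
    Xge i l = subst (- X i (np ↑ʳ l) ≤_) s1 (∑-single (λ i → Xle0 i l) i)
      where s1 : ∑ℚ (λ i → - X i (np ↑ʳ l)) ≡ 1ℚ
            s1 = trans (∑-neg (λ i → X i (np ↑ʳ l))) (trans (cong -_ (trans (sumX (np ↑ʳ l)) (wR l))) refl)
    -- On the first block (x_i)_j > -1 (this uses p_j < rk), so (x_i)_j ≥ 0 as it is an integer;
    -- as these sum to 0 over i, they vanish.
    Y≥0 : ∀ i j → 0ℚ ≤ X i (j ↑ˡ m)
    Y≥0 i j = ι≤ {+ 0} {xs i (j ↑ˡ m)} (neg1< (ι<⁻ {ℤ.-[1+ 0 ]} {xs i (j ↑ˡ m)} (0<→< (subst (0ℚ <_) (lemS Y) Y1pos))))
      where
      Y : ℚ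
      Y = X i (j ↑ˡ m)
      P : ℚ
      P = ιn (p j)
      Xl : ℚ
      Xl = X i (np ↑ʳ l0)
      lemS : ∀ y → y + 1ℚ ≡ y - (- 1ℚ)
      lemS = solve-∀ ℚring
      c1 : 0ℚ ≤ Y + P * t0 i
      c1 = subst (λ z → 0ℚ ≤ Y + ιn z * t0 i) (qL j) (cnn i (j ↑ˡ m))
      c2 : 0ℚ ≤ P * (Xl + 1ℚ)
      c2 = 0≤* (0≤ιn (p j)) (subst (0ℚ ≤_) (lem Xl) (≤→0≤ (Xge i l0)))
        where lem : ∀ a → 1ℚ - (- a) ≡ a + 1ℚ
              lem = solve-∀ ℚring
      c3 : 0ℚ < R - P
      c3 = <→0< (ι< {+ p j} {+ rk} (ℤ.+<+ (plt j)))
      eqY : R * (Y + 1ℚ) ≡ R * (Y + P * t0 i) + P * (Xl + 1ℚ) + (R - P) - P * (Xl + R * t0 i)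
      eqY = lem R Y P (t0 i) Xl
        where lem : ∀ r y a t x → r * (y + 1ℚ) ≡ r * (y + a * t) + a * (x + 1ℚ) + (r - a) - a * (x + r * t)
              lem = solve-∀ ℚring
      RY : 0ℚ < R * (Y + 1ℚ)
      RY = subst (0ℚ <_) (sym (trans eqY (trans (cong (λ z → R * (Y + P * t0 i) + P * (Xl + 1ℚ) + (R - P) - P * z) (XRt i l0))
                                                (lem (R * (Y + P * t0 i) + P * (Xl + 1ℚ) + (R - P)) P))))
             (subst (0ℚ <_) (ℚP.+-comm (R - P) _) (0<+ c3 (0≤+ (0≤* (ℚP.<⇒≤ Rpos) c1) c2)))
        where lem : ∀ a b → a - b * 0ℚ ≡ a
              lem = solve-∀ ℚring
      Y1pos : 0ℚ < Y + 1ℚ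
      Y1pos = cancel< Rpos RY
    Y0 : ∀ j → X zero (j ↑ˡ m) ≡ 0ℚ
    Y0 j = ∑-zero-each (λ i → Y≥0 i j) (trans (sumX (j ↑ˡ m)) (wL j)) zero
    S : ℚ
    S = ∑ℚ (λ l → X zero (np ↑ʳ l))
    A0 : A zero ≡ 1ℚ - S
    A0 = trans (teq zero) (cong (λ z → 1ℚ - z) (trans (∑-split np m (X zero))
           (trans (cong (_+ S) (trans (∑-cong Y0) (∑-0 {np}))) (ℚP.+-identityˡ S))))
    KXl : ∀ l → K * X zero (np ↑ʳ l) ≡ - A zero
    KXl l = trans (lem (K * X zero (np ↑ʳ l)) (A zero)) (trans (cong (_- A zero) (T0 zero l)) (ℚP.+-identityˡ (- A zero)))
      where lem : ∀ a b → a ≡ (a + b) - b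
            lem = solve-∀ ℚring
    KS : K * S ≡ Km * (- A zero)
    KS = trans (sym (∑-* K (λ l → X zero (np ↑ʳ l)))) (trans (∑-cong KXl) (∑-const {m} (- A zero)))
    S1A : 1ℚ - A zero ≡ S
    S1A = trans (cong (λ z → 1ℚ - z) A0) (lem S)
      where lem : ∀ s → 1ℚ - (1ℚ - s) ≡ s
            lem = solve-∀ ℚring
    KcA : Kc * A zero ≡ K
    KcA = trans (lem Kc Km (A zero))
          (trans (cong (λ z → K - (K * z + Km * A zero)) S1A)
          (trans (cong (λ z → K - (z + Km * A zero)) KS) (lem2 K Km (A zero))))
      where lem : ∀ a b x → a * x ≡ (a + b) - ((a + b) * (1ℚ - x) + b * x)
            lem = solve-∀ ℚring
            lem2 : ∀ k b x → k - (b * (- x) + b * x) ≡ k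
            lem2 = solve-∀ ℚring
    -- Solving for x_0: c (x_0)_l = -1 with (x_0)_l an integer, so c = 1.
    KcX : Kc * X zero (np ↑ʳ l0) + 1ℚ ≡ 0ℚ
    KcX = *-cancel Kpos (trans (lem K Kc (X zero (np ↑ʳ l0)))
            (trans (cong (λ z → Kc * z + K) (KXl l0)) (trans (lem3 Kc (A zero) K) (trans (cong (λ z → - z + K) KcA) (trans (lem2 K) (sym (ℚP.*-zeroʳ K)))))))
      where lem : ∀ k c x → k * (c * x + 1ℚ) ≡ c * (k * x) + k
            lem = solve-∀ ℚring
            lem2 : ∀ k → - k + k ≡ 0ℚ
            lem2 = solve-∀ ℚring
            lem3 : ∀ c a k → c * (- a) + k ≡ - (c * a) + k
            lem3 = solve-∀ ℚring
    c≡1 : suc c' ≡ 1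
    c≡1 = ℕP.m*n≡1⇒m≡1 (suc c') ℤ.∣ xs zero (np ↑ʳ l0) ∣
            (trans (sym (ℤP.abs-* (+ suc c') (xs zero (np ↑ʳ l0)))) (cong ℤ.∣_∣ zeq))
      where
      zeq : + suc c' ℤ.* xs zero (np ↑ʳ l0) ≡ ℤ.-[1+ 0 ]
      zeq = ι-inj (trans (ι* (+ suc c') (xs zero (np ↑ʳ l0))) (trans (lem (Kc * X zero (np ↑ʳ l0))) (trans (cong (_- 1ℚ) KcX) refl)))
        where lem : ∀ a → a ≡ a + 1ℚ - 1ℚ
              lem = solve-∀ ℚring

  rk≡Np : ∀ {np m : ℕ} (p : Vector ℕ np) (rk : ℕ) → 0 ℕ.< m → 0 ℕ.< rk → (∀ i → p i ℕ.< rk) →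
          rk ∣ suc (∑ℕ p) → IDP (Δ (Concat.q {np} {m} p rk)) → rk ≡ suc (∑ℕ p)
  rk≡Np p rk mpos rkpos plt (divides zero eq) idp = ⊥-elim (ℕP.1+n≢0 eq)
  rk≡Np {np} {m} p rk mpos rkpos plt (divides (suc c') eq) idp =
    trans (sym (ℕP.*-identityˡ rk)) (trans (cong (ℕ._* rk) (sym (IDPForcesEquality.c≡1 {np} {m} p rk mpos rkpos plt c' eq idp))) (sym eq))

  module Balanced {np m : ℕ} (p : Vector ℕ np) (rk : ℕ) (rkNp : rk ≡ suc (∑ℕ p)) where
    open Concat {np} {m} p rk public
    Km : ℚ
    Km = ιn m
    R : ℚ
    R = ιn rk
    RN : R ≡ Nq p
    RN = trans (cong ιn rkNp) (sym (Nq≡ p))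
    K1 : ℚ
    K1 = 1ℚ + Km
    K1pos : 0ℚ < K1
    K1pos = 0<+ 0<1 (0≤ιn m)
    NqK : Nq q ≡ K1 * R
    NqK = trans Nqq (trans (cong (λ z → z + Km * R) (sym RN)) (lem R Km))
      where lem : ∀ r k → r + k * r ≡ (1ℚ + k) * r
            lem = solve-∀ ℚring
    module LatticeFamily {c : ℕ} (xs : Fin c → ZPt (np ℕ.+ m)) (xin : ∀ i → InP (Δ q) (embed (xs i))) where
      X : Fin c → Fin (np ℕ.+ m) → ℚ
      X i j = ι (xs i j)
      ch : ∀ i → DilCoords q 1ℚ (embed (xs i))
      ch i = dil⇒coords q 1ℚ (embed (xs i)) (xin i)
      t0 : Fin c → ℚ
      t0 i = proj₁ (ch i)
      t0nn : ∀ i → 0ℚ ≤ t0 i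
      t0nn i = proj₁ (proj₂ (ch i))
      teq : ∀ i → t0 i * Nq q ≡ 1ℚ - ∑ℚ (X i)
      teq i = proj₁ (proj₂ (proj₂ (ch i)))
      cnn : ∀ i j → 0ℚ ≤ X i j + ιn (q j) * t0 i
      cnn i = proj₂ (proj₂ (proj₂ (ch i)))
      cL : ∀ i j → 0ℚ ≤ X i (j ↑ˡ m) + ιn (p j) * t0 i
      cL i j = subst (λ z → 0ℚ ≤ X i (j ↑ˡ m) + ιn z * t0 i) (qL j) (cnn i (j ↑ˡ m))
      cR : ∀ i l → 0ℚ ≤ X i (np ↑ʳ l) + R * t0 i
      cR i l = subst (λ z → 0ℚ ≤ X i (np ↑ʳ l) + ιn z * t0 i) (qR l) (cnn i (np ↑ʳ l))
      Sx : Fin c → ℚ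
      Sx i = ∑ℚ (λ j → X i (j ↑ˡ m))
      Sl : Fin c → ℚ
      Sl i = ∑ℚ (λ l → X i (np ↑ʳ l))
      ∑X : ∀ i → ∑ℚ (X i) ≡ Sx i + Sl i
      ∑X i = ∑-split np m (X i)
      teq' : ∀ i → K1 * (R * t0 i) ≡ 1ℚ - Sx i - Sl i
      teq' i = trans (lem K1 R (t0 i)) (trans (cong (t0 i *_) (sym NqK)) (trans (teq i) (trans (cong (λ z → 1ℚ - z) (∑X i)) (lem2 (Sx i) (Sl i)))))
        where lem : ∀ k r t → k * (r * t) ≡ t * (k * r)
              lem = solve-∀ ℚring
              lem2 : ∀ a b → 1ℚ - (a + b) ≡ 1ℚ - a - b
              lem2 = solve-∀ ℚring
      -- g i l = (x_i)_l - Sx i + 1 ≥ 0, a sum of nonnegative DilCoords terms.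
      g : Fin c → Fin m → ℚ
      g i l = X i (np ↑ʳ l) - Sx i + 1ℚ
      gnn : ∀ i l → 0ℚ ≤ g i l
      gnn i l = 0≤-by ((X i (np ↑ʳ l) + R * t0 i) + ∑ℚ (λ l' → X i (np ↑ʳ l') + R * t0 i)) eqg
                  (0≤+ (cR i l) (∑-nonneg (cR i)))
        where
        eqg : g i l ≡ (X i (np ↑ʳ l) + R * t0 i) + ∑ℚ (λ l' → X i (np ↑ʳ l') + R * t0 i)
        eqg = sym (trans (cong (λ z → (X i (np ↑ʳ l) + R * t0 i) + z)
                           (trans (∑-+ (λ l' → X i (np ↑ʳ l')) (λ _ → R * t0 i)) (cong (λ z → Sl i + z) (∑-const {m} (R * t0 i)))))
                  (trans (lem (X i (np ↑ʳ l)) R (t0 i) (Sl i) Km) (trans (cong (λ z → X i (np ↑ʳ l) + Sl i + z) (teq' i)) (lem2 (X i (np ↑ʳ l)) (Sl i) (Sx i)))))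
          where lem : ∀ x r t s k → (x + r * t) + (s + k * (r * t)) ≡ x + s + (1ℚ + k) * (r * t)
                lem = solve-∀ ℚring
                lem2 : ∀ x s a → x + s + (1ℚ - a - s) ≡ x - a + 1ℚ
                lem2 = solve-∀ ℚring

  -- Δ_p inherits the IDP: lift w ∈ c·Δ_p to W = (w, ∑w - c, …, ∑w - c) ∈ c·Δ_q,
  -- decompose W in Δ_q and keep the first blocks of the summands.
  IDP-p : ∀ {np m : ℕ} (p : Vector ℕ np) (rk : ℕ) (rkNp : rk ≡ suc (∑ℕ p)) →
          IDP (Δ (Concat.q {np} {m} p rk)) → IDP (Δ p)
  IDP-p {np} {m} p rk rkNp idp c' w hin = xs' , xin' , xsum'
    where
    open Balanced {np} {m} p rk rkNp
    c : ℚ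
    c = ι (+ suc c')
    chp : DilCoords p c (embed w)
    chp = dil⇒coords p c (embed w) hin
    tp : ℚ
    tp = proj₁ chp
    tpnn : 0ℚ ≤ tp
    tpnn = proj₁ (proj₂ chp)
    tpeq : tp * Nq p ≡ c - ∑ℚ (embed w)
    tpeq = proj₁ (proj₂ (proj₂ chp))
    tpc : ∀ j → 0ℚ ≤ embed w j + ιn (p j) * tp
    tpc = proj₂ (proj₂ (proj₂ chp))
    sw : ℤ
    sw = ∑ℤ w
    ιsw : ι sw ≡ ∑ℚ (embed w)
    ιsw = ι∑ w
    W : ZPt (np ℕ.+ m)
    W = VF._++_ {m = np} {n = m} w (λ _ → sw ℤ.- + suc c')
    WL : ∀ j → ι (W (j ↑ˡ m)) ≡ ι (w j)
    WL j = cong ι (++ˡ {a = np} {b = m} w (λ _ → sw ℤ.- + suc c') j)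
    WR : ∀ l → ι (W (np ↑ʳ l)) ≡ ∑ℚ (embed w) - c
    WR l = trans (cong ι (++ʳ {a = np} {b = m} w (λ _ → sw ℤ.- + suc c') l)) (trans (ι-sub sw (+ suc c')) (cong (_- c) ιsw))
    ∑W : ∑ℚ (embed W) ≡ ∑ℚ (embed w) + Km * (∑ℚ (embed w) - c)
    ∑W = trans (∑-split np m (embed W)) (cong₂ _+_ (∑-cong WL) (trans (∑-cong WR) (∑-const {m} _)))
    inW : InDil (Δ q) c (embed W)
    inW = coords⇒dil q c (embed W) (tp , tpnn , eq , split-ind {np} {m} (λ j → 0ℚ ≤ embed W j + ιn (q j) * tp) coL coR)
      where
      eq : tp * Nq q ≡ c - ∑ℚ (embed W)
      eq = trans (cong (tp *_) NqK) (trans (cong (λ z → tp * (K1 * z)) RN) (trans (lem tp K1 (Nq p))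
            (trans (cong (K1 *_) tpeq) (trans (lem2 Km c (∑ℚ (embed w))) (cong (λ z → c - z) (sym ∑W))))))
        where lem : ∀ t k n → t * (k * n) ≡ k * (t * n)
              lem = solve-∀ ℚring
              lem2 : ∀ k c s → (1ℚ + k) * (c - s) ≡ c - (s + k * (s - c))
              lem2 = solve-∀ ℚring
      coL : ∀ j → 0ℚ ≤ embed W (j ↑ˡ m) + ιn (q (j ↑ˡ m)) * tp
      coL j = subst (0ℚ ≤_) (sym (cong₂ (λ a b → a + ιn b * tp) (WL j) (qL j))) (tpc j)
      coR : ∀ l → 0ℚ ≤ embed W (np ↑ʳ l) + ιn (q (np ↑ʳ l)) * tp
      coR l = 0≤-by 0ℚ (trans (cong₂ (λ a b → a + ιn b * tp) (WR l) (qR l))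
                       (trans (cong (λ z → ∑ℚ (embed w) - c + z * tp) RN) (trans (cong (λ z → ∑ℚ (embed w) - c + z) (trans (ℚP.*-comm (Nq p) tp) tpeq)) (lem (∑ℚ (embed w)) c))))
                    ℚP.≤-refl
        where lem : ∀ s c → s - c + (c - s) ≡ 0ℚ
              lem = solve-∀ ℚring
    xs : Fin (suc c') → ZPt (np ℕ.+ m)
    xs = proj₁ (idp c' W inW)
    xin : ∀ i → InP (Δ q) (embed (xs i))
    xin = proj₁ (proj₂ (idp c' W inW))
    xsum : ∀ j → ∑ℤ (λ i → xs i j) ≡ W j
    xsum = proj₂ (proj₂ (idp c' W inW))
    open LatticeFamily xs xin
    sumX : ∀ j → ∑ℚ (λ i → X i j) ≡ ι (W j)
    sumX j = trans (sym (ι∑ (λ i → xs i j))) (cong ι (xsum j))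
    Σg : ∀ l → ∑ℚ (λ i → g i l) ≡ 0ℚ
    Σg l = trans (∑-+ (λ i → X i (np ↑ʳ l) - Sx i) (λ _ → 1ℚ))
           (trans (cong₂ _+_ (∑-sub (λ i → X i (np ↑ʳ l)) Sx) (∑-const {suc c'} 1ℚ))
           (trans (cong₂ (λ a b → a - b + ιn (suc c') * 1ℚ) (trans (sumX (np ↑ʳ l)) (WR l))
                         (trans (∑-swap (λ i j → X i (j ↑ˡ m))) (∑-cong (λ j → trans (sumX (j ↑ˡ m)) (WL j)))))
                  (lem (∑ℚ (embed w)) c)))
      where lem : ∀ s c → s - c - s + c * 1ℚ ≡ 0ℚ
            lem = solve-∀ ℚring
    -- Each g i l vanishes (nonnegative with zero sum), so the summands' first
    -- blocks lie in Δ_p with the same t_0.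
    g0 : ∀ i l → g i l ≡ 0ℚ
    g0 i l = ∑-zero-each (λ i → gnn i l) (Σg l) i
    xs' : Fin (suc c') → ZPt np
    xs' i j = xs i (j ↑ˡ m)
    xin' : ∀ i → InP (Δ p) (embed (xs' i))
    xin' i = coords⇒dil p 1ℚ (embed (xs' i)) (t0 i , t0nn i , eq , cL i)
      where
      Xl : ∀ l → X i (np ↑ʳ l) ≡ Sx i - 1ℚ
      Xl l = trans (lem (X i (np ↑ʳ l)) (Sx i)) (trans (cong (λ z → z + Sx i - 1ℚ) (g0 i l)) (lem2 (Sx i)))
        where lem : ∀ x s → x ≡ (x - s + 1ℚ) + s - 1ℚ
              lem = solve-∀ ℚring
              lem2 : ∀ s → 0ℚ + s - 1ℚ ≡ s - 1ℚ
              lem2 = solve-∀ ℚring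
      SlEq : Sl i ≡ Km * (Sx i - 1ℚ)
      SlEq = trans (∑-cong Xl) (∑-const {m} (Sx i - 1ℚ))
      eq : t0 i * Nq p ≡ 1ℚ - ∑ℚ (embed (xs' i))
      eq = *-cancel K1pos (trans (cong (λ z → K1 * (t0 i * z)) (sym RN))
             (trans (lem K1 (t0 i) R) (trans (teq' i) (trans (cong (λ z → 1ℚ - Sx i - z) SlEq) (lem2 Km (Sx i))))))
        where lem : ∀ k t r → k * (t * r) ≡ k * (r * t)
              lem = solve-∀ ℚring
              lem2 : ∀ k s → 1ℚ - s - k * (s - 1ℚ) ≡ (1ℚ + k) * (1ℚ - s)
              lem2 = solve-∀ ℚring
    xsum' : ∀ j → ∑ℤ (λ i → xs' i j) ≡ w j
    xsum' j = trans (xsum (j ↑ˡ m)) (++ˡ {a = np} {b = m} w (λ _ → sw ℤ.- + suc c') j)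

  Σh : ∀ m → Σq (VF.replicate m 1) ≡ ιn m
  Σh m = trans (∑-const {m} 1ℚ) (ℚP.*-identityʳ (ιn m))

  -- Δ_(1^m) inherits the IDP: lift w ∈ c·Δ_(1^m) to W = (0, w) ∈ c·Δ_q,
  -- decompose W in Δ_q and map each summand x to (x_l - Sx)_l.
  IDP-h : ∀ {np m : ℕ} (p : Vector ℕ np) (rk : ℕ) (rkNp : rk ≡ suc (∑ℕ p)) → 0 ℕ.< rk →
          IDP (Δ (Concat.q {np} {m} p rk)) → IDP (Δ (VF.replicate m 1))
  IDP-h {np} {m} p rk rkNp rkpos idp c' w hin = us , uin , usum
    where
    open Balanced {np} {m} p rk rkNp
    h : Vector ℕ m
    h = VF.replicate m 1
    c : ℚ
    c = ι (+ suc c')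
    chh : DilCoords h c (embed w)
    chh = dil⇒coords h c (embed w) hin
    th : ℚ
    th = proj₁ chh
    thnn : 0ℚ ≤ th
    thnn = proj₁ (proj₂ chh)
    theq : th * Nq h ≡ c - ∑ℚ (embed w)
    theq = proj₁ (proj₂ (proj₂ chh))
    thc : ∀ l → 0ℚ ≤ embed w l + 1ℚ * th
    thc = proj₂ (proj₂ (proj₂ chh))
    Nh : Nq h ≡ K1
    Nh = cong (λ z → 1ℚ + z) (Σh m)
    Rpos : 0ℚ < R
    Rpos = 0<ιn rkpos
    wr : ℚ
    wr = proj₁ (inv R Rpos)
    wrpos : 0ℚ < wr
    wrpos = proj₁ (proj₂ (inv R Rpos))
    Rw : R * wr ≡ 1ℚ
    Rw = proj₂ (proj₂ (inv R Rpos))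
    -- The lift W = (0, w) ∈ c·Δ_q, with t_0 scaled by 1/rk.
    W : ZPt (np ℕ.+ m)
    W = VF._++_ {m = np} {n = m} (λ _ → + 0) w
    WL : ∀ j → ι (W (j ↑ˡ m)) ≡ 0ℚ
    WL j = cong ι (++ˡ {a = np} {b = m} (λ _ → + 0) w j)
    WR : ∀ l → ι (W (np ↑ʳ l)) ≡ ι (w l)
    WR l = cong ι (++ʳ {a = np} {b = m} (λ _ → + 0) w l)
    ∑W : ∑ℚ (embed W) ≡ ∑ℚ (embed w)
    ∑W = trans (∑-split np m (embed W)) (trans (cong₂ _+_ (trans (∑-cong WL) (∑-0 {np})) (∑-cong WR)) (ℚP.+-identityˡ _))
    tq : ℚ
    tq = th * wr
    inW : InDil (Δ q) c (embed W)
    inW = coords⇒dil q c (embed W) (tq , 0≤* thnn (ℚP.<⇒≤ wrpos) , eq , split-ind {np} {m} (λ j → 0ℚ ≤ embed W j + ιn (q j) * tq) coL coR)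
      where
      eq : tq * Nq q ≡ c - ∑ℚ (embed W)
      eq = trans (cong (tq *_) NqK) (trans (lem th wr K1 R) (trans (cong (λ z → th * K1 * z) Rw)
            (trans (ℚP.*-identityʳ (th * K1)) (trans (cong (th *_) (sym Nh)) (trans theq (cong (λ z → c - z) (sym ∑W)))))))
        where lem : ∀ t w k r → t * w * (k * r) ≡ t * k * (r * w)
              lem = solve-∀ ℚring
      coL : ∀ j → 0ℚ ≤ embed W (j ↑ˡ m) + ιn (q (j ↑ˡ m)) * tq
      coL j = 0≤-by (ιn (q (j ↑ˡ m)) * tq) (trans (cong (_+ ιn (q (j ↑ˡ m)) * tq) (WL j)) (ℚP.+-identityˡ _))
                (0≤* (0≤ιn (q (j ↑ˡ m))) (0≤* thnn (ℚP.<⇒≤ wrpos)))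
      coR : ∀ l → 0ℚ ≤ embed W (np ↑ʳ l) + ιn (q (np ↑ʳ l)) * tq
      coR l = subst (0ℚ ≤_) (sym (trans (cong₂ (λ a b → a + ιn b * tq) (WR l) (qR l))
                   (trans (lem (ι (w l)) R th wr) (trans (cong (λ z → ι (w l) + th * z) Rw) (lem2 (ι (w l)) th)))))
                (thc l)
        where lem : ∀ x r t w → x + r * (t * w) ≡ x + t * (r * w)
              lem = solve-∀ ℚring
              lem2 : ∀ x t → x + t * 1ℚ ≡ x + 1ℚ * t
              lem2 = solve-∀ ℚring
    xs : Fin (suc c') → ZPt (np ℕ.+ m)
    xs = proj₁ (idp c' W inW)
    xin : ∀ i → InP (Δ q) (embed (xs i))
    xin = proj₁ (proj₂ (idp c' W inW))
    xsum : ∀ j → ∑ℤ (λ i → xs i j) ≡ W j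
    xsum = proj₂ (proj₂ (idp c' W inW))
    open LatticeFamily xs xin
    sumX : ∀ j → ∑ℚ (λ i → X i j) ≡ ι (W j)
    sumX j = trans (sym (ι∑ (λ i → xs i j))) (cong ι (xsum j))
    us : Fin (suc c') → ZPt m
    us i l = xs i (np ↑ʳ l) ℤ.- ∑ℤ (λ j → xs i (j ↑ˡ m))
    ιus : ∀ i l → ι (us i l) ≡ X i (np ↑ʳ l) - Sx i
    ιus i l = trans (ι-sub (xs i (np ↑ʳ l)) _) (cong (λ z → X i (np ↑ʳ l) - z) (ι∑ (λ j → xs i (j ↑ˡ m))))
    uin : ∀ i → InP (Δ h) (embed (us i))
    uin i = coords⇒dil h 1ℚ (embed (us i)) (tt , ttnn , eq , co)
      where
      tt : ℚ
      tt = R * t0 i + Sx i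
      ttnn : 0ℚ ≤ tt
      ttnn = 0≤-by (∑ℚ (λ j → X i (j ↑ˡ m) + ιn (p j) * t0 i) + t0 i) eqt (0≤+ (∑-nonneg (cL i)) (t0nn i))
        where
        eqt : tt ≡ ∑ℚ (λ j → X i (j ↑ˡ m) + ιn (p j) * t0 i) + t0 i
        eqt = sym (trans (cong (_+ t0 i) (trans (∑-+ (λ j → X i (j ↑ˡ m)) (λ j → ιn (p j) * t0 i)) (cong (λ z → Sx i + z) (∑-*ʳ (t0 i) (λ j → ιn (p j))))))
                  (trans (lem (Sx i) (Σq p) (t0 i)) (cong (λ z → z * t0 i + Sx i) (sym RN))))
          where lem : ∀ s a t → s + a * t + t ≡ (1ℚ + a) * t + s
                lem = solve-∀ ℚring
      ∑u : ∑ℚ (embed (us i)) ≡ Sl i - Km * Sx i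
      ∑u = trans (∑-cong (ιus i)) (trans (∑-sub (λ l → X i (np ↑ʳ l)) (λ _ → Sx i)) (cong (λ z → Sl i - z) (∑-const {m} (Sx i))))
      eq : tt * Nq h ≡ 1ℚ - ∑ℚ (embed (us i))
      eq = trans (cong (tt *_) Nh) (trans (lem R (t0 i) (Sx i) Km) (trans (cong (λ z → z + K1 * Sx i) (teq' i))
             (trans (lem2 (Sx i) (Sl i) Km) (cong (λ z → 1ℚ - z) (sym ∑u)))))
        where lem : ∀ r t s k → (r * t + s) * (1ℚ + k) ≡ (1ℚ + k) * (r * t) + (1ℚ + k) * s
              lem = solve-∀ ℚring
              lem2 : ∀ s l k → 1ℚ - s - l + (1ℚ + k) * s ≡ 1ℚ - (l - k * s)
              lem2 = solve-∀ ℚring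
      co : ∀ l → 0ℚ ≤ embed (us i) l + ιn (h l) * tt
      co l = subst (0ℚ ≤_) (sym (trans (cong (_+ 1ℚ * tt) (ιus i l)) (lem (X i (np ↑ʳ l)) (Sx i) (R * t0 i)))) (cR i l)
        where lem : ∀ x s a → x - s + 1ℚ * (a + s) ≡ x + a
              lem = solve-∀ ℚring
    usum : ∀ l → ∑ℤ (λ i → us i l) ≡ w l
    usum l = ι-inj (trans (ι∑ (λ i → us i l)) (trans (∑-cong (λ i → ιus i l))
               (trans (∑-sub (λ i → X i (np ↑ʳ l)) Sx) (trans (cong₂ _-_ (trans (sumX (np ↑ʳ l)) (WR l))
                  (trans (∑-swap (λ i j → X i (j ↑ˡ m))) (trans (∑-cong (λ j → trans (sumX (j ↑ˡ m)) (WL j))) (∑-0 {np}))))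
                  (lem (ι (w l)))))))
      where lem : ∀ a → a - 0ℚ ≡ a
            lem = solve-∀ ℚring

  module Shear (np m : ℕ) where
    shear : ℤ → ZMat (np ℕ.+ m)
    shear s i j = [ (λ a → [ (λ b → eZ a b) , (λ _ → + 0) ] (F.splitAt np j)) ,
                  (λ a → [ (λ _ → s) , (λ b → eZ a b) ] (F.splitAt np j)) ] (F.splitAt np i)
    mLL : ∀ s a b → shear s (a ↑ˡ m) (b ↑ˡ m) ≡ eZ a b
    mLL s a b rewrite FP.splitAt-↑ˡ np a m | FP.splitAt-↑ˡ np b m = refl
    mLR : ∀ s a b → shear s (a ↑ˡ m) (np ↑ʳ b) ≡ + 0
    mLR s a b rewrite FP.splitAt-↑ˡ np a m | FP.splitAt-↑ʳ np m b = refl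
    mRL : ∀ s a b → shear s (np ↑ʳ a) (b ↑ˡ m) ≡ s
    mRL s a b rewrite FP.splitAt-↑ʳ np m a | FP.splitAt-↑ˡ np b m = refl
    mRR : ∀ s a b → shear s (np ↑ʳ a) (np ↑ʳ b) ≡ eZ a b
    mRR s a b rewrite FP.splitAt-↑ʳ np m a | FP.splitAt-↑ʳ np m b = refl

    ∑ι0 : ∀ {k} (f : Fin k → ℚ) → ∑ℚ (λ j → f j * ι (+ 0)) ≡ 0ℚ
    ∑ι0 {k} f = trans (∑-cong (λ j → ℚP.*-zeroʳ (f j))) (∑-0 {k})
    ∑0ι : ∀ {k} (f : Fin k → ℚ) → ∑ℚ (λ j → ι (+ 0) * f j) ≡ 0ℚ
    ∑0ι {k} f = trans (∑-cong (λ j → ℚP.*-zeroˡ (f j))) (∑-0 {k})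

    shear-inverse : ∀ s s' → s ℤ.+ s' ≡ + 0 → ∀ i k → (shear s ·ᵐ shear s') i k ≡ Id i k
    shear-inverse s s' ss' i k = ι-inj (trans (ι∑ (λ j → shear s i j ℤ.* shear s' j k))
                            (trans (∑-cong (λ j → ι* (shear s i j) (shear s' j k))) (main i k)))
      where
      P : Fin (np ℕ.+ m) → Fin (np ℕ.+ m) → Set
      P i k = ∑ℚ (λ j → ι (shear s i j) * ι (shear s' j k)) ≡ ι (Id i k)
      sp : ∀ i k → ∑ℚ (λ j → ι (shear s i j) * ι (shear s' j k)) ≡
                   ∑ℚ (λ j → ι (shear s i (j ↑ˡ m)) * ι (shear s' (j ↑ˡ m) k)) + ∑ℚ (λ j → ι (shear s i (np ↑ʳ j)) * ι (shear s' (np ↑ʳ j) k))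
      sp i k = ∑-split np m (λ j → ι (shear s i j) * ι (shear s' j k))
      main : ∀ i k → P i k
      main = split-ind {np} {m} (λ i → ∀ k → P i k)
        (λ a → split-ind {np} {m} (P (a ↑ˡ m))
          (λ b → trans (sp (a ↑ˡ m) (b ↑ˡ m))
            (trans (cong₂ _+_ (trans (∑-cong (λ j → cong₂ (λ u v → ι u * ι v) (mLL s a j) (mLL s' j b))) (sel (λ j → ι (eZ a j)) b))
                              (trans (∑-cong (λ j → cong₂ (λ u v → ι u * ι v) (mLR s a j) (mRL s' j b))) (∑0ι {m} (λ _ → ι s'))))
            (trans (ℚP.+-identityʳ _) (cong ι (sym (eZ-ll m a b))))))
          (λ b → trans (sp (a ↑ˡ m) (np ↑ʳ b))
            (trans (cong₂ _+_ (trans (∑-cong (λ j → cong₂ (λ u v → ι u * ι v) (mLL s a j) (mLR s' j b))) (∑ι0 (λ j → ι (eZ a j))))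
                              (trans (∑-cong (λ j → cong₂ (λ u v → ι u * ι v) (mLR s a j) (mRR s' j b))) (∑0ι (λ j → ι (eZ j b)))))
            (cong ι (sym (eZ-lr m a b))))))
        (λ a → split-ind {np} {m} (P (np ↑ʳ a))
          (λ b → trans (sp (np ↑ʳ a) (b ↑ˡ m))
            (trans (cong₂ _+_ (trans (∑-cong (λ j → cong₂ (λ u v → ι u * ι v) (mRL s a j) (mLL s' j b))) (sel (λ _ → ι s) b))
                              (trans (∑-cong (λ j → trans (cong₂ (λ u v → ι u * ι v) (mRR s a j) (mRL s' j b)) (ℚP.*-comm _ (ι s')))) (sel' (λ _ → ι s') a)))
            (trans (sym (ι+ s s')) (trans (cong ι ss') (cong ι (sym (eZ-rl m b a)))))))
          (λ b → trans (sp (np ↑ʳ a) (np ↑ʳ b))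
            (trans (cong₂ _+_ (trans (∑-cong (λ j → cong₂ (λ u v → ι u * ι v) (mRL s a j) (mLR s' j b))) (∑ι0 {np} (λ _ → ι s)))
                              (trans (∑-cong (λ j → cong₂ (λ u v → ι u * ι v) (mRR s a j) (mRR s' j b))) (sel (λ j → ι (eZ a j)) b)))
            (trans (ℚP.+-identityˡ _) (cong ι (sym (eZ-rr np a b)))))))

  -- The affine unimodular map y ↦ (y', y'' - (∑ y') + 1) (shear -1 plus the
  -- translation bv) carries Δ_q onto Δ_p ∗_0 Δ_(1^m).
  module FreeSum {np m : ℕ} (p : Vector ℕ np) (rk : ℕ) (rkNp : rk ≡ suc (∑ℕ p)) (rkpos : 0 ℕ.< rk) where
    open Balanced {np} {m} p rk rkNp public
    open Shear np m
    h : Vector ℕ m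
    h = VF.replicate m 1
    ST : LPoly (np ℕ.+ m)
    ST = star (Δ p) (Δ h) zero
    U U' : ZMat (np ℕ.+ m)
    U = shear ℤ.-[1+ 0 ]
    U' = shear (+ 1)
    bv : ZPt (np ℕ.+ m)
    bv = VF._++_ {m = np} {n = m} (λ _ → + 0) (λ _ → + 1)
    Sy' : Pt (np ℕ.+ m) → ℚ
    Sy' y = ∑ℚ (λ j → y (j ↑ˡ m))
    Sy'' : Pt (np ℕ.+ m) → ℚ
    Sy'' y = ∑ℚ (λ l → y (np ↑ʳ l))

    selc : ∀ {k} (f : Fin k → ℚ) a → ∑ℚ (λ j → ι (eZ a j) * f j) ≡ f a
    selc f a = trans (∑-cong (λ j → ℚP.*-comm (ι (eZ a j)) (f j))) (sel' f a)

    actL : ∀ y a → act U bv y (a ↑ˡ m) ≡ y (a ↑ˡ m)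
    actL y a = trans (cong₂ _+_ (∑-split np m (λ j → ι (U (a ↑ˡ m) j) * y j)) (cong ι (++ˡ {a = np} {b = m} (λ _ → + 0) (λ _ → + 1) a)))
      (trans (cong (λ z → z + 0ℚ) (cong₂ _+_ (trans (∑-cong (λ j → cong (λ u → ι u * y (j ↑ˡ m)) (mLL ℤ.-[1+ 0 ] a j))) (selc (λ j → y (j ↑ˡ m)) a))
                                                (trans (∑-cong (λ j → cong (λ u → ι u * y (np ↑ʳ j)) (mLR ℤ.-[1+ 0 ] a j))) (∑0ι {m} (λ j → y (np ↑ʳ j))))))
             (lem (y (a ↑ˡ m))))
      where lem : ∀ a → a + 0ℚ + 0ℚ ≡ a
            lem = solve-∀ ℚring

    actR : ∀ y a → act U bv y (np ↑ʳ a) ≡ y (np ↑ʳ a) - Sy' y + 1ℚ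
    actR y a = trans (cong₂ _+_ (∑-split np m (λ j → ι (U (np ↑ʳ a) j) * y j)) (cong ι (++ʳ {a = np} {b = m} (λ _ → + 0) (λ _ → + 1) a)))
      (trans (cong (λ z → z + 1ℚ) (cong₂ _+_ (trans (∑-cong (λ j → cong (λ u → ι u * y (j ↑ˡ m)) (mRL ℤ.-[1+ 0 ] a j))) (∑-* (- 1ℚ) (λ j → y (j ↑ˡ m))))
                                                (trans (∑-cong (λ j → cong (λ u → ι u * y (np ↑ʳ j)) (mRR ℤ.-[1+ 0 ] a j))) (selc (λ j → y (np ↑ʳ j)) a))))
             (lem (Sy' y) (y (np ↑ʳ a))))
      where lem : ∀ s a → (- 1ℚ) * s + a + 1ℚ ≡ a - s + 1ℚ
            lem = solve-∀ ℚring

    VL : ∀ i j → vert ST (i ↑ˡ suc m) j ≡ (vert (Δ p) i VF.++ (λ _ → + 0)) j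
    VL i j = cong (λ f → f j) (++ˡ {A = ZPt (np ℕ.+ m)} {a = suc np} {b = suc m}
               (λ i → vert (Δ p) i VF.++ (λ _ → + 0))
               (λ i → (λ _ → + 0) VF.++ (λ j → vert (Δ h) i j ℤ.- vert (Δ h) zero j)) i)
    VR : ∀ l j → vert ST (suc np ↑ʳ l) j ≡ ((λ _ → + 0) VF.++ (λ j → vert (Δ h) l j ℤ.- vert (Δ h) zero j)) j
    VR l j = cong (λ f → f j) (++ʳ {A = ZPt (np ℕ.+ m)} {a = suc np} {b = suc m}
               (λ i → vert (Δ p) i VF.++ (λ _ → + 0))
               (λ i → (λ _ → + 0) VF.++ (λ j → vert (Δ h) i j ℤ.- vert (Δ h) zero j)) l)
    VLL : ∀ i a → vert ST (i ↑ˡ suc m) (a ↑ˡ m) ≡ vert (Δ p) i a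
    VLL i a = trans (VL i (a ↑ˡ m)) (++ˡ {a = np} {b = m} (vert (Δ p) i) (λ _ → + 0) a)
    VLR : ∀ i a → vert ST (i ↑ˡ suc m) (np ↑ʳ a) ≡ + 0
    VLR i a = trans (VL i (np ↑ʳ a)) (++ʳ {a = np} {b = m} (vert (Δ p) i) (λ _ → + 0) a)
    VRL : ∀ l a → vert ST (suc np ↑ʳ l) (a ↑ˡ m) ≡ + 0
    VRL l a = trans (VR l (a ↑ˡ m)) (++ˡ {a = np} {b = m} (λ _ → + 0) (λ j → vert (Δ h) l j ℤ.- vert (Δ h) zero j) a)
    VRR : ∀ l a → vert ST (suc np ↑ʳ l) (np ↑ʳ a) ≡ vert (Δ h) l a ℤ.- vert (Δ h) zero a
    VRR l a = trans (VR l (np ↑ʳ a)) (++ʳ {a = np} {b = m} (λ _ → + 0) (λ j → vert (Δ h) l j ℤ.- vert (Δ h) zero j) a)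

    module _ (t : Fin (suc np ℕ.+ suc m) → ℚ) where
      sP : Fin (suc np) → ℚ
      sP i = t (i ↑ˡ suc m)
      sQ : Fin (suc m) → ℚ
      sQ l = t (suc np ↑ʳ l)
      SQ : ℚ
      SQ = ∑ℚ (λ l → sQ (suc l))
      SP : ℚ
      SP = ∑ℚ (λ i → sP (suc i))
      starΣ : ∑ℚ t ≡ (sP zero + SP) + (sQ zero + SQ)
      starΣ = ∑-split (suc np) (suc m) t
      starL : ∀ a → ∑ℚ (λ i → t i * ι (vert ST i (a ↑ˡ m))) ≡ sP zero * (- ιn (p a)) + sP (suc a)
      starL a = trans (∑-split (suc np) (suc m) (λ i → t i * ι (vert ST i (a ↑ˡ m))))
        (trans (cong₂ _+_ (trans (∑-cong (λ i → cong (λ u → sP i * ι u) (VLL i a))) (coord p sP a))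
                          (trans (∑-cong (λ l → cong (λ u → sQ l * ι u) (VRL l a))) (∑ι0 sQ)))
               (ℚP.+-identityʳ _))
      starR : ∀ a → ∑ℚ (λ i → t i * ι (vert ST i (np ↑ʳ a))) ≡ sQ (suc a) + SQ
      starR a = trans (∑-split (suc np) (suc m) (λ i → t i * ι (vert ST i (np ↑ʳ a))))
        (trans (cong₂ _+_ (trans (∑-cong (λ i → cong (λ u → sP i * ι u) (VLR i a))) (∑ι0 sP))
                          (trans (∑-cong (λ l → cong (λ u → sQ l * ι u) (VRR l a))) second))
               (ℚP.+-identityˡ _))
        where
        second : ∑ℚ (λ l → sQ l * ι (vert (Δ h) l a ℤ.- vert (Δ h) zero a)) ≡ sQ (suc a) + SQ
        second = trans (cong₂ _+_ (ℚP.*-zeroʳ (sQ zero))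
                        (trans (∑-cong (λ l → trans (cong (λ u → sQ (suc l) * u) (ι-sub (eZ l a) ℤ.-[1+ 0 ])) (lem (sQ (suc l)) (ι (eZ l a)))))
                        (trans (∑-+ (λ l → sQ (suc l) * ι (eZ l a)) (λ l → sQ (suc l))) (cong (_+ SQ) (sel (λ l → sQ (suc l)) a)))))
                       (ℚP.+-identityˡ _)
          where lem : ∀ s x → s * (x - (- 1ℚ)) ≡ s * x + s
                lem = solve-∀ ℚring

    ∑+c : ∀ {k} (f : Fin k → ℚ) c → ∑ℚ (λ i → f i + c) ≡ ∑ℚ f + ιn k * c
    ∑+c {k} f c = trans (∑-+ f (λ _ → c)) (cong (λ z → ∑ℚ f + z) (∑-const {k} c))

    Σp : ℚ
    Σp = Σq p

    -- Weights of the image of y ∈ Δ_q: (t_0, y'_a + p_a t_0) on Δ_p and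
    -- (0, y''_l + rk t_0) on Δ_(1^m).
    fwd : ∀ y → InP (Δ q) y → InP ST (act U bv y)
    fwd y yin = t , nn , sm , co
      where
      ch : DilCoords q 1ℚ y
      ch = dil⇒coords q 1ℚ y yin
      t0 : ℚ
      t0 = proj₁ ch
      t0nn : 0ℚ ≤ t0
      t0nn = proj₁ (proj₂ ch)
      teq : t0 * Nq q ≡ 1ℚ - ∑ℚ y
      teq = proj₁ (proj₂ (proj₂ ch))
      cnn : ∀ j → 0ℚ ≤ y j + ιn (q j) * t0
      cnn = proj₂ (proj₂ (proj₂ ch))
      sPf : Fin (suc np) → ℚ
      sPf zero = t0
      sPf (suc a) = y (a ↑ˡ m) + ιn (p a) * t0
      sQf : Fin (suc m) → ℚ
      sQf zero = 0ℚ
      sQf (suc l) = y (np ↑ʳ l) + R * t0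
      t : Fin (suc np ℕ.+ suc m) → ℚ
      t = VF._++_ {m = suc np} {n = suc m} sPf sQf
      tL : ∀ i → sP t i ≡ sPf i
      tL i = ++ˡ {a = suc np} {b = suc m} sPf sQf i
      tR : ∀ l → sQ t l ≡ sQf l
      tR l = ++ʳ {a = suc np} {b = suc m} sPf sQf l
      nnP : ∀ i → 0ℚ ≤ sPf i
      nnP zero = t0nn
      nnP (suc a) = subst (λ z → 0ℚ ≤ y (a ↑ˡ m) + ιn z * t0) (qL a) (cnn (a ↑ˡ m))
      nnQ : ∀ l → 0ℚ ≤ sQf l
      nnQ zero = ℚP.≤-refl
      nnQ (suc l) = subst (λ z → 0ℚ ≤ y (np ↑ʳ l) + ιn z * t0) (qR l) (cnn (np ↑ʳ l))
      nn : ∀ i → 0ℚ ≤ t i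
      nn = split-ind {suc np} {suc m} (λ i → 0ℚ ≤ t i)
             (λ i → subst (0ℚ ≤_) (sym (tL i)) (nnP i)) (λ l → subst (0ℚ ≤_) (sym (tR l)) (nnQ l))
      SQf : SQ t ≡ Sy'' y + Km * (R * t0)
      SQf = trans (∑-cong (λ l → tR (suc l))) (∑+c (λ l → y (np ↑ʳ l)) (R * t0))
      SPf : SP t ≡ Sy' y + Σp * t0
      SPf = trans (∑-cong (λ a → tL (suc a))) (tsum p (λ a → y (a ↑ˡ m)) t0)
      K1Rt : K1 * (R * t0) ≡ 1ℚ - Sy' y - Sy'' y
      K1Rt = trans (lem K1 R t0) (trans (cong (t0 *_) (sym NqK)) (trans teq (trans (cong (λ z → 1ℚ - z) (∑-split np m y)) (lem2 (Sy' y) (Sy'' y)))))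
        where lem : ∀ k r t → k * (r * t) ≡ t * (k * r)
              lem = solve-∀ ℚring
              lem2 : ∀ a b → 1ℚ - (a + b) ≡ 1ℚ - a - b
              lem2 = solve-∀ ℚring
      sm : ∑ℚ t ≡ 1ℚ
      sm = trans (starΣ t) (trans (cong₂ (λ a b → (a + SP t) + (b + SQ t)) (tL zero) (tR zero))
             (trans (cong₂ (λ a b → (t0 + a) + (0ℚ + b)) SPf SQf)
             (trans (lem t0 (Sy' y) Σp (Sy'' y) Km R)
             (trans (cong (λ z → t0 * z + (Sy' y + Sy'' y)) (sym Nqq))
             (trans (cong₂ _+_ teq (sym (∑-split np m y))) (lem3 (∑ℚ y)))))))
        where
        lem : ∀ t a s b k r → (t + (a + s * t)) + (0ℚ + (b + k * (r * t))) ≡ t * ((1ℚ + s) + k * r) + (a + b)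
        lem = solve-∀ ℚring
        lem3 : ∀ s → 1ℚ - s + s ≡ 1ℚ
        lem3 = solve-∀ ℚring
      co : ∀ j → ∑ℚ (λ i → t i * ι (vert ST i j)) ≡ act U bv y j
      co = split-ind {np} {m} (λ j → ∑ℚ (λ i → t i * ι (vert ST i j)) ≡ act U bv y j) coL coR
        where
        coL : ∀ a → ∑ℚ (λ i → t i * ι (vert ST i (a ↑ˡ m))) ≡ act U bv y (a ↑ˡ m)
        coL a = trans (starL t a) (trans (cong₂ (λ u v → u * (- ιn (p a)) + v) (tL zero) (tL (suc a)))
                  (trans (lem t0 (ιn (p a)) (y (a ↑ˡ m))) (sym (actL y a))))
          where lem : ∀ t p y → t * (- p) + (y + p * t) ≡ y
                lem = solve-∀ ℚring
        coR : ∀ a → ∑ℚ (λ i → t i * ι (vert ST i (np ↑ʳ a))) ≡ act U bv y (np ↑ʳ a)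
        coR a = trans (starR t a) (trans (cong₂ _+_ (tR (suc a)) SQf)
                  (trans (lem (y (np ↑ʳ a)) R t0 (Sy'' y) Km) (trans (cong (λ z → y (np ↑ʳ a) + Sy'' y + z) K1Rt)
                    (trans (lem2 (y (np ↑ʳ a)) (Sy'' y) (Sy' y)) (sym (actR y a))))))
          where lem : ∀ x r t s k → (x + r * t) + (s + k * (r * t)) ≡ x + s + (1ℚ + k) * (r * t)
                lem = solve-∀ ℚring
                lem2 : ∀ x s a → x + s + (1ℚ - a - s) ≡ x - a + 1ℚ
                lem2 = solve-∀ ℚring

    Rpos : 0ℚ < R
    Rpos = 0<ιn rkpos
    wr : ℚ
    wr = proj₁ (inv R Rpos)
    wrpos : 0ℚ < wr
    wrpos = proj₁ (proj₂ (inv R Rpos))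
    Rw : R * wr ≡ 1ℚ
    Rw = proj₂ (proj₂ (inv R Rpos))

    -- Conversely t_0 = sP 0 + sQ 0 / rk recovers DilCoords for y ∈ Δ_q.
    bwd : ∀ y → InP ST (act U bv y) → InP (Δ q) y
    bwd y (t , nn , sm , co) = coords⇒dil q 1ℚ y (t0 , t0nn , eq , split-ind {np} {m} (λ j → 0ℚ ≤ y j + ιn (q j) * t0) cL' cR')
      where
      P0 : ℚ
      P0 = sP t zero
      Q0 : ℚ
      Q0 = sQ t zero
      SPt : ℚ
      SPt = SP t
      SQt : ℚ
      SQt = SQ t
      t0 : ℚ
      t0 = P0 + Q0 * wr
      t0nn : 0ℚ ≤ t0
      t0nn = 0≤+ (nn _) (0≤* (nn _) (ℚP.<⇒≤ wrpos))
      O : (P0 + SPt) + (Q0 + SQt) ≡ 1ℚ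
      O = trans (sym (starΣ t)) sm
      yL : ∀ a → y (a ↑ˡ m) ≡ P0 * (- ιn (p a)) + sP t (suc a)
      yL a = trans (sym (actL y a)) (trans (sym (co (a ↑ˡ m))) (starL t a))
      yR : ∀ a → y (np ↑ʳ a) ≡ (sQ t (suc a) + SQt) + (Sy' y - 1ℚ)
      yR a = trans (lem (y (np ↑ʳ a)) (Sy' y)) (trans (cong (λ z → z + (Sy' y - 1ℚ)) (sym (actR y a)))
               (cong (λ z → z + (Sy' y - 1ℚ)) (trans (sym (co (np ↑ʳ a))) (starR t a))))
        where lem : ∀ x s → x ≡ (x - s + 1ℚ) + (s - 1ℚ)
              lem = solve-∀ ℚring
      Sy'eq : Sy' y ≡ P0 * (- Σp) + SPt
      Sy'eq = trans (∑-cong yL) (trans (∑-+ (λ a → P0 * (- ιn (p a))) (λ a → sP t (suc a)))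
                (cong (_+ SPt) (trans (∑-* P0 (λ a → - ιn (p a))) (cong (P0 *_) (∑-neg (λ a → ιn (p a)))))))
      Sy''eq : Sy'' y ≡ (SQt + Km * SQt) + Km * (Sy' y - 1ℚ)
      Sy''eq = trans (∑-cong yR) (trans (∑+c (λ a → sQ t (suc a) + SQt) (Sy' y - 1ℚ))
                 (cong (_+ Km * (Sy' y - 1ℚ)) (∑+c (λ a → sQ t (suc a)) SQt)))
      RP0 : R * P0 ≡ (1ℚ + Σp) * P0
      RP0 = cong (_* P0) RN
      eq : t0 * Nq q ≡ 1ℚ - ∑ℚ y
      eq = trans (cong (t0 *_) NqK) (trans (lem P0 Q0 wr K1 R) (trans (cong₂ (λ a b → K1 * (a + Q0 * b)) RP0 Rw)
             (trans (lem2 K1 Σp P0 Q0 SPt SQt) (trans (cong (λ z → K1 * (z + Σp * P0 - SPt - SQt)) O)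
             (sym (trans (cong (λ z → 1ℚ - z) (∑-split np m y)) (trans (cong (λ z → 1ℚ - (Sy' y + z)) Sy''eq)
                    (trans (cong (λ z → 1ℚ - (z + ((SQt + Km * SQt) + Km * (z - 1ℚ)))) Sy'eq) (lem3 P0 Σp SPt SQt Km)))))))))
        where
        lem : ∀ a b w k r → (a + b * w) * (k * r) ≡ k * (r * a + b * (r * w))
        lem = solve-∀ ℚring
        lem2 : ∀ k s a b c d → k * ((1ℚ + s) * a + b * 1ℚ) ≡ k * (((a + c) + (b + d)) + s * a - c - d)
        lem2 = solve-∀ ℚring
        lem3 : ∀ a s c d k → 1ℚ - ((a * (- s) + c) + ((d + k * d) + k * ((a * (- s) + c) - 1ℚ))) ≡ (1ℚ + k) * (1ℚ + s * a - c - d)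
        lem3 = solve-∀ ℚring
      cL' : ∀ a → 0ℚ ≤ y (a ↑ˡ m) + ιn (q (a ↑ˡ m)) * t0
      cL' a = 0≤-by (sP t (suc a) + ιn (p a) * (Q0 * wr))
                (trans (cong₂ (λ u v → u + ιn v * t0) (yL a) (qL a)) (lem P0 (ιn (p a)) (sP t (suc a)) (Q0 * wr)))
                (0≤+ (nn _) (0≤* (0≤ιn (p a)) (0≤* (nn _) (ℚP.<⇒≤ wrpos))))
        where lem : ∀ z p s b → z * (- p) + s + p * (z + b) ≡ s + p * b
              lem = solve-∀ ℚring
      cR' : ∀ a → 0ℚ ≤ y (np ↑ʳ a) + ιn (q (np ↑ʳ a)) * t0
      cR' a = 0≤-by (sQ t (suc a))
                (trans (cong₂ (λ u v → u + ιn v * t0) (yR a) (qR a))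
                (trans (cong (λ z → (sQ t (suc a) + SQt) + (z - 1ℚ) + R * t0) Sy'eq)
                (trans (lem (sQ t (suc a)) SQt P0 Σp SPt R Q0 wr)
                (trans (cong₂ (λ u v → sQ t (suc a) + SQt + (P0 * (- Σp) + SPt) - 1ℚ + u + Q0 * v) RP0 Rw)
                (trans (lem2 (sQ t (suc a)) SQt P0 Σp SPt Q0) (trans (cong (λ z → sQ t (suc a) + (z - 1ℚ)) O) (lem4 (sQ t (suc a)))))))))
                (nn _)
        where lem : ∀ x d a s c r b w → (x + d) + ((a * (- s) + c) - 1ℚ) + r * (a + b * w) ≡ x + d + (a * (- s) + c) - 1ℚ + r * a + b * (r * w)
              lem = solve-∀ ℚring
              lem2 : ∀ x d a s c b → x + d + (a * (- s) + c) - 1ℚ + (1ℚ + s) * a + b * 1ℚ ≡ x + (((a + c) + (b + d)) - 1ℚ)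
              lem2 = solve-∀ ℚring
              lem4 : ∀ x → x + (1ℚ - 1ℚ) ≡ x
              lem4 = solve-∀ ℚring

    unimodular-equiv : UnimodEquiv (Δ q) ST
    unimodular-equiv = U , U' , bv , shear-inverse ℤ.-[1+ 0 ] (+ 1) refl , shear-inverse (+ 1) ℤ.-[1+ 0 ] refl ,
            (λ y → mk⇔ (fwd y) (bwd y))

  free-sum-decomposition :
    ∀ {np m} (p : Vector ℕ np) (rk : ℕ) → 0 ℕ.< m → 0 ℕ.< rk →
    (∀ i → 0 ℕ.< p i) → (∀ i → p i ℕ.< rk) → (∀ i → p i ∣ rk) →
    Reflexive (Δ (p VF.++ VF.replicate m rk)) → IDP (Δ (p VF.++ VF.replicate m rk)) →
    UnimodEquiv (Δ (p VF.++ VF.replicate m rk)) (star (Δ p) (Δ (VF.replicate m 1)) zero)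
    × Reflexive (Δ p) × IDP (Δ p)
    × Reflexive (Δ (VF.replicate m 1)) × IDP (Δ (VF.replicate m 1))
  free-sum-decomposition {np} {m} p rk mpos rkpos ppos plt pdiv R I =
    FreeSum.unimodular-equiv {np} {m} p rk rk≡N rkpos ,
    reflexive-of-divides p ppos (λ k → subst (p k ∣_) rk≡N (pdiv k)) ,
    IDP-p {np} {m} p rk rk≡N I ,
    reflexive-of-divides (VF.replicate m 1) (λ _ → ℕ.s≤s ℕ.z≤n) (λ _ → 1∣ _) ,
    IDP-h {np} {m} p rk rk≡N rkpos I
    where
    rk≡N : rk ≡ suc (∑ℕ p)
    rk≡N = rk≡Np {np} {m} p rk mpos rkpos plt (Concat.rk∣Np {np} {m} p rk mpos rkpos R) I

open import Defs
open import Data.Nat using (ℕ; _<_; _≤_)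
open import Data.Nat.Divisibility using (_∣_)
open import Data.Fin using (Fin; zero; suc) renaming (_<_ to _<ᶠ_)
open import Data.Vec using (Vec; []; _∷_; lookup; sum)
open import Data.Vec.Functional using (replicate; _++_)
open import Data.Product using (_×_)
open import Function using (_∘_)
open import Relation.Binary.PropositionalEquality using (subst; sym)
open Simplices using (split-ind; ++ˡ; ++ʳ; free-sum-decomposition)

expand-entries : ∀ {k} (P : ℕ → Set) (r x : Vec ℕ k) →
                 (∀ i → P (lookup r i)) → ∀ i → P (expand r x i)
expand-entries P [] [] _ ()
expand-entries P (r ∷ rs) (x ∷ xs) h =
  split-ind (λ i → P ((replicate x r ++ expand rs xs) i))
    (λ i → subst P (sym (++ˡ (replicate x r) (expand rs xs) i)) (h zero))
    (λ i → subst P (sym (++ʳ (replicate x r) (expand rs xs) i)) (expand-entries P rs xs (h ∘ suc) i))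

-- Proposition 3.6.  With p = (r_1^{x_1}, …, r_{k-1}^{x_{k-1}}) this is the
-- free-sum decomposition for the weights p and rk = r_k.
proposition3p6 : (j : ℕ) → 1 ≤ j →
    (r x : Vec ℕ j) (rk xk : ℕ) →
    (∀ i → 0 < lookup r i) → 0 < rk →
    (∀ i → 0 < lookup x i) → 0 < xk →
    (∀ i i' → i <ᶠ i' → lookup r i < lookup r i') →
    (∀ i → lookup r i < rk) →
    (∀ i → lookup r i ∣ rk) →
    Reflexive (Δ (expand r x ++ replicate xk rk)) →
    IDP (Δ (expand r x ++ replicate xk rk)) →
    UnimodEquiv (Δ (expand r x ++ replicate xk rk))
    (star (Δ (expand r x)) (Δ (replicate xk 1)) zero)
    × Reflexive (Δ (expand r x)) × IDP (Δ (expand r x))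
    × Reflexive (Δ (replicate xk 1)) × IDP (Δ (replicate xk 1))
proposition3p6 j _ r x rk xk rpos rkpos _ xkpos _ rlt rdiv =
  free-sum-decomposition (expand r x) rk xkpos rkpos
    (entries (0 <_) rpos) (entries (_< rk) rlt) (entries (_∣ rk) rdiv)
  where
  entries : (P : ℕ → Set) → (∀ i → P (lookup r i)) → ∀ i → P (expand r x i)
  entries P = expand-entries P r x
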